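{- Let $q$ be an odd prime power, $\omega$ a non-square in $\mathbb F_q$, and $\epsilon\in\mathbb F_{q^2}$ with $\epsilon^2=\omega$; write each $z\in\mathbb F_{q^2}$ as $z=z_1+\epsilon z_2$ with $z_1,z_2\in\mathbb F_q$. Let $\mathcal C$ be the non-singular conic $aX^2+bXY+cXZ+dYZ+eZ^2=0$ of $\mathrm{PG}(2,q^2)$ with $a,b,c,d,e\in\mathbb F_{q^2}$, $b\neq0$, $d=1$, $b_2\neq 0$, $b_1d_2-b_2d_1\neq 0$, and such that $-bcd+ad^2+b^2e$ is a square in $\mathbb F_{q^2}$. Put $A=a_1b_2-a_2b_1$, $B=b_2c_1-b_1c_2-a_2d_1+a_1d_2$, $C=-c_2d_1+c_1d_2+b_2e_1-b_1e_2$, $D=d_2e_1-d_1e_2$ and let $\mathcal S$ be the cubic surface of $\mathrm{PG}(3,q)$ in coordinates $(t_1:t_2:X:Z)$ with equation $$2t_1t_2(b_1X+d_1Z)-(t_1^2+\omega t_2^2)(b_2X+d_2Z)+AX^3+BX^2Z+CXZ^2+DZ^3=0.$$ Let $\mathcal S_q$ be the number of $\mathbb F_q$-rational points of $\mathcal S$, $n_0$ the number of those with $t_1=t_2=0$, and $n_\infty$ the number of those with $X=Z=0$. Then $E_q(\mathcal C)=\frac12(\mathcal S_q-n_0-n_\infty)$.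
   Context: $\mathrm{PG}(2,q)$ is canonically embedded in $\mathrm{PG}(2,q^2)$; a point not on $\mathcal C$ is external if it lies on two tangent lines to $\mathcal C$, and $E_q(\mathcal C)$ is the number of points of $\mathrm{PG}(2,q)$ external to $\mathcal C$. -}

module Defs where

open import Level using (0ℓ)
open import Data.Nat using (ℕ; suc)
import Data.Nat
import Relation.Nullary
open import Data.Bool using (Bool; true; false; _∧_; not)
open import Data.Product using (_×_; _,_; Σ; ∃)
open import Data.List using (List; []; _∷_; _++_; map; length; filterᵇ; cartesianProduct)
open import Data.List.Membership.Propositional using (_∈_)
open import Data.List.Relation.Unary.Unique.Propositional using (Unique)
open import Relation.Binary.PropositionalEquality using (_≡_; _≢_; refl)
open import Relation.Binary.Definitions using (DecidableEquality)
open import Relation.Nullary using (does)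
open import Algebra.Structures using (IsCommutativeRing)

record FiniteField : Set₁ where
  infixl 6 _+_ _-_
  infixl 7 _*_
  infix  8 -_
  field
    Carrier   : Set
    _≟_       : DecidableEquality Carrier
    _+_ _*_   : Carrier → Carrier → Carrier
    -_        : Carrier → Carrier
    0# 1#     : Carrier
    isCommutativeRing : IsCommutativeRing _≡_ _+_ _*_ -_ 0# 1#
    0≢1       : 0# ≢ 1#
    inverse   : ∀ x → x ≢ 0# → ∃ λ y → x * y ≡ 1#
    elements  : List Carrier
    complete  : ∀ x → x ∈ elements
    unique    : Unique elements

  order : ℕ
  order = length elements

  _-_ : Carrier → Carrier → Carrier
  x - y = x + (- y)

  2# : Carrier
  2# = 1# + 1#

  isSquare : Carrier → Set
  isSquare x = ∃ λ y → y * y ≡ x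

count : {A : Set} → (A → Bool) → List A → ℕ
count p xs = length (filterᵇ p xs)

-- normalised representatives of the points of PG(2,K) and PG(3,K):
-- the first nonzero coordinate equals 1.
PG2 : {A : Set} → A → A → List A → List (A × A × A)
PG2 z o es =
  map (λ { (y , w) → (o , y , w) }) (cartesianProduct es es)
  ++ map (λ w → (z , o , w)) es
  ++ ((z , z , o) ∷ [])

PG3 : {A : Set} → A → A → List A → List (A × A × A × A)
PG3 z o es =
  map (λ { (x , y , w) → (o , x , y , w) })
      (cartesianProduct es (cartesianProduct es es))
  ++ map (λ { (y , w) → (z , o , y , w) }) (cartesianProduct es es)
  ++ map (λ w → (z , z , o , w)) es
  ++ ((z , z , z , o) ∷ [])

-- Everything below is relative to a finite field F = F_q and a fixed
-- element ω of F (the non-square).  F_{q^2} is realised as F × F,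
-- the pair (z₁ , z₂) standing for z₁ + ε z₂ with ε² = ω.

module Ext (𝔽 : FiniteField) (ω : FiniteField.Carrier 𝔽) where
  open FiniteField 𝔽

  F2 : Set
  F2 = Carrier × Carrier

  infixl 6 _+₂_ _-₂_
  infixl 7 _*₂_
  infix  8 -₂_

  _+₂_ : F2 → F2 → F2
  (z₁ , z₂) +₂ (w₁ , w₂) = (z₁ + w₁ , z₂ + w₂)

  -₂_ : F2 → F2
  -₂ (z₁ , z₂) = (- z₁ , - z₂)

  _-₂_ : F2 → F2 → F2
  z -₂ w = z +₂ (-₂ w)

  _*₂_ : F2 → F2 → F2
  (z₁ , z₂) *₂ (w₁ , w₂) = (z₁ * w₁ + ω * (z₂ * w₂) , z₁ * w₂ + z₂ * w₁)

  0₂ 1₂ 2₂ : F2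
  0₂ = (0# , 0#)
  1₂ = (1# , 0#)
  2₂ = 1₂ +₂ 1₂

  emb : Carrier → F2
  emb x = (x , 0#)

  _≟₂_ : DecidableEquality F2
  (z₁ , z₂) ≟₂ (w₁ , w₂) with z₁ ≟ w₁ | z₂ ≟ w₂
  ... | Relation.Nullary.yes refl | Relation.Nullary.yes refl = Relation.Nullary.yes refl
  ... | Relation.Nullary.no p | _ = Relation.Nullary.no (λ { refl → p refl })
  ... | _ | Relation.Nullary.no p = Relation.Nullary.no (λ { refl → p refl })

  eq₂ : F2 → F2 → Bool
  eq₂ x y = does (x ≟₂ y)

  elements₂ : List F2
  elements₂ = cartesianProduct elements elements

  isSquare₂ : F2 → Set
  isSquare₂ x = ∃ λ y → y *₂ y ≡ x

  points₂ : List (F2 × F2 × F2)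
  points₂ = PG2 0₂ 1₂ elements₂

  pointsq : List (F2 × F2 × F2)
  pointsq = map (λ { (x , y , z) → (emb x , emb y , emb z) }) (PG2 0# 1# elements)

  -- lines of PG(2,q^2), given by their coordinates [u : v : w]
  lines₂ : List (F2 × F2 × F2)
  lines₂ = points₂

  incident : (F2 × F2 × F2) → (F2 × F2 × F2) → Bool
  incident (u , v , w) (x , y , z) = eq₂ (u *₂ x +₂ v *₂ y +₂ w *₂ z) 0₂

  module Conic (a b c d e : F2) where

    form : F2 × F2 × F2 → F2
    form (x , y , z) =
      a *₂ x *₂ x +₂ b *₂ x *₂ y +₂ c *₂ x *₂ z +₂ d *₂ y *₂ z +₂ e *₂ z *₂ z

    onC : F2 × F2 × F2 → Bool
    onC P = eq₂ (form P) 0₂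

    -- determinant of the symmetric matrix of the quadratic form
    -- (entries 2a, b, c / b, 0, d / c, d, 2e)
    det3 : F2 → F2 → F2 → F2 → F2 → F2 → F2 → F2 → F2 → F2
    det3 m₁₁ m₁₂ m₁₃ m₂₁ m₂₂ m₂₃ m₃₁ m₃₂ m₃₃ =
      m₁₁ *₂ (m₂₂ *₂ m₃₃ -₂ m₂₃ *₂ m₃₂)
      -₂ m₁₂ *₂ (m₂₁ *₂ m₃₃ -₂ m₂₃ *₂ m₃₁)
      +₂ m₁₃ *₂ (m₂₁ *₂ m₃₂ -₂ m₂₂ *₂ m₃₁)

    NonSingular : Set
    NonSingular = det3 (2₂ *₂ a) b c b 0₂ d c d (2₂ *₂ e) ≢ 0₂

    tangent : F2 × F2 × F2 → Bool
    tangent ℓ = does (count (λ P → incident ℓ P ∧ onC P) points₂ Data.Nat.≟ 1)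

    nTangents : F2 × F2 × F2 → ℕ
    nTangents P = count (λ ℓ → tangent ℓ ∧ incident ℓ P) lines₂

    external : F2 × F2 × F2 → Bool
    external P = not (onC P) ∧ does (nTangents P Data.Nat.≟ 2)

    Eq : ℕ
    Eq = count external pointsq

  module Cubic (b₁ b₂ d₁ d₂ A B C D : Carrier) where

    cubic : Carrier × Carrier × Carrier × Carrier → Carrier
    cubic (t₁ , t₂ , X , Z) =
      2# * t₁ * t₂ * (b₁ * X + d₁ * Z)
      - (t₁ * t₁ + ω * (t₂ * t₂)) * (b₂ * X + d₂ * Z)
      + A * X * X * X + B * X * X * Z + C * X * Z * Z + D * Z * Z * Z

    onS : Carrier × Carrier × Carrier × Carrier → Bool
    onS P = does (cubic P ≟ 0#)

    isZ : Carrier → Bool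
    isZ x = does (x ≟ 0#)

    Sq n₀ n∞ : ℕ
    Sq = count onS (PG3 0# 1# elements)
    n₀ = count (λ { (t₁ , t₂ , X , Z) → onS (t₁ , t₂ , X , Z) ∧ isZ t₁ ∧ isZ t₂ })
               (PG3 0# 1# elements)
    n∞ = count (λ { (t₁ , t₂ , X , Z) → onS (t₁ , t₂ , X , Z) ∧ isZ X ∧ isZ Z })
               (PG3 0# 1# elements)

module Submission where

-- Everything is counted on vectors rather than on projective points: for a homogeneous condition the
-- nonzero vectors satisfying it are q - 1 times the projective points satisfying it.
--
-- Over F_{q²}, restricting the conic to a line ℓ gives a binary form whose discriminant is -C*(ℓ), C* the
-- dual (adjugate) conic, so ℓ meets C in R(-C*(ℓ)) points, R(Δ) ∈ {0, 1, 2} being the number of square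
-- roots of Δ; dually, the tangents through a point P ∉ C number R(-8 det(C) C(P)). The determinant is
-- -2(-bcd + ad² + b²e), a square by hypothesis, so this is R(C(P)), and 2 [P external] + [P ∈ C] = R(C(P))
-- for every point P of PG(2,q).
--
-- For P = (X : Y : Z) in PG(2,q) the form is affine in Y, C = Y (L₁ + ε L₂) + (G₁ + ε G₂), and for fixed
-- t = t₁ + ε t₂ ≠ 0 and (X , Z) ≠ 0 the equation C = t² is a linear system in Y with (L₁ , L₂) ≠ 0 (here
-- b₁d₂ - b₂d₁ ≠ 0 is used); it is solvable, uniquely, exactly when its determinant, which is the cubic at
-- (t₁ : t₂ : X : Z), vanishes. Hence 2 (q - 1) E_q counts the vectors of S with (t₁ , t₂) ≠ 0 ≠ (X , Z),
-- and the remaining vectors of S are those counted by n₀ and n∞.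

open import Defs
open import Algebra.Bundles using (CommutativeRing; CommutativeMonoid; RawRing)
open import Algebra.Solver.Ring.AlmostCommutativeRing
  using (AlmostCommutativeRing; fromCommutativeRing; _-Raw-AlmostCommutative⟶_)
open import Algebra.Structures using (IsCommutativeRing)
open import Data.Bool using (Bool; true; false; not; _∧_)
import Data.Bool.Properties as Bool
open import Data.Empty using (⊥-elim)
open import Data.Integer as ℤ using (ℤ; -[1+_]; _⊖_)
import Data.Integer.Properties as ℤ
open import Data.List using (List; []; _∷_; _++_; map; length; cartesianProduct)
import Data.List.Properties as List
open import Data.List.Membership.Propositional using (_∈_; lose)
open import Data.List.Membership.Propositional.Properties using (∈-cartesianProduct⁺)
open import Data.List.Relation.Unary.All as All using (All; []; _∷_)
open import Data.List.Relation.Unary.Any using (here; there; any?; satisfied)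
open import Data.List.Relation.Unary.Unique.Propositional using (Unique; []; _∷_)
open import Data.List.Relation.Unary.Unique.Propositional.Properties using (cartesianProduct⁺)
open import Data.Maybe using (Maybe; just; nothing)
open import Data.Nat as ℕ using (ℕ; zero; suc; _∸_) renaming (_+_ to _+ℕ_; _*_ to _*ℕ_)
import Data.Nat.Properties as ℕ
open import Data.Nat.Solver using (module +-*-Solver)
open import Data.Product using (_×_; _,_; proj₁; proj₂; ∃)
open import Data.Sign as Sign using (Sign)
open import Data.Sum using (_⊎_; inj₁; inj₂)
open import Level using (0ℓ)
open import Relation.Binary.Definitions using (DecidableEquality)
import Relation.Binary.PropositionalEquality as ≡
open ≡ using (_≡_)
open import Relation.Nullary using (Dec; yes; no; does; ¬_)

open import Algebra.Properties.CommutativeSemigroup ℕ.+-commutativeSemigroup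
  using () renaming (interchange to +-interchange)
open import Algebra.Properties.CommutativeSemigroup (CommutativeMonoid.commutativeSemigroup Bool.∧-commutativeMonoid)
  using () renaming (x∙yz≈y∙xz to ∧-swap₁₂; x∙yz≈z∙yx to ∧-swap₁₃)

module IntegerCoefficientSolver {c ℓ} (R : CommutativeRing c ℓ) where
  open CommutativeRing R
  open import Algebra.Properties.Ring ring
    using (-‿distribˡ-*; -‿distribʳ-*; -‿involutive; -0#≈0#; -‿+-comm)
  open import Relation.Binary.Reasoning.Setoid setoid

  -- 1 ↦ 1# rather than 1# + 0#, so that the literal 2 denotes 2# = 1# + 1# definitionally.
  fromℕ : ℕ → Carrier
  fromℕ zero          = 0#
  fromℕ (suc zero)    = 1#
  fromℕ (suc (suc n)) = 1# + fromℕ (suc n)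

  fromℕ-suc : ∀ n → fromℕ (suc n) ≈ 1# + fromℕ n
  fromℕ-suc zero    = sym (+-identityʳ 1#)
  fromℕ-suc (suc n) = refl

  fromℕ-+ : ∀ m n → fromℕ (m ℕ.+ n) ≈ fromℕ m + fromℕ n
  fromℕ-+ zero    n = sym (+-identityˡ _)
  fromℕ-+ (suc m) n = begin
    fromℕ (suc (m ℕ.+ n))       ≈⟨ fromℕ-suc (m ℕ.+ n) ⟩
    1# + fromℕ (m ℕ.+ n)        ≈⟨ +-congˡ (fromℕ-+ m n) ⟩
    1# + (fromℕ m + fromℕ n)    ≈⟨ sym (+-assoc _ _ _) ⟩
    (1# + fromℕ m) + fromℕ n    ≈⟨ +-congʳ (sym (fromℕ-suc m)) ⟩
    fromℕ (suc m) + fromℕ n     ∎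

  fromℕ-* : ∀ m n → fromℕ (m ℕ.* n) ≈ fromℕ m * fromℕ n
  fromℕ-* zero    n = sym (zeroˡ _)
  fromℕ-* (suc m) n = begin
    fromℕ (n ℕ.+ m ℕ.* n)           ≈⟨ fromℕ-+ n (m ℕ.* n) ⟩
    fromℕ n + fromℕ (m ℕ.* n)       ≈⟨ +-cong (sym (*-identityˡ _)) (fromℕ-* m n) ⟩
    1# * fromℕ n + fromℕ m * fromℕ n ≈⟨ sym (distribʳ _ _ _) ⟩
    (1# + fromℕ m) * fromℕ n         ≈⟨ *-congʳ (sym (fromℕ-suc m)) ⟩
    fromℕ (suc m) * fromℕ n          ∎

  fromℤ : ℤ → Carrier
  fromℤ (ℤ.+ n)    = fromℕ n
  fromℤ -[1+ n ] = - fromℕ (suc n)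

  fromℤ-⊖ : ∀ m n → fromℤ (m ⊖ n) ≈ fromℕ m - fromℕ n
  fromℤ-⊖ zero    zero    = sym (-‿inverseʳ 0#)
  fromℤ-⊖ zero    (suc n) = sym (+-identityˡ _)
  fromℤ-⊖ (suc m) zero    = sym (trans (+-congˡ -0#≈0#) (+-identityʳ _))
  fromℤ-⊖ (suc m) (suc n) = begin
    fromℤ (suc m ⊖ suc n)                   ≡⟨ ≡.cong fromℤ (ℤ.[1+m]⊖[1+n]≡m⊖n m n) ⟩
    fromℤ (m ⊖ n)                           ≈⟨ fromℤ-⊖ m n ⟩
    fromℕ m - fromℕ n                       ≈⟨ sym (cancel (fromℕ m) (fromℕ n)) ⟩
    (1# + fromℕ m) - (1# + fromℕ n)         ≈⟨ sym (+-cong (fromℕ-suc m) (-‿cong (fromℕ-suc n))) ⟩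
    fromℕ (suc m) - fromℕ (suc n)           ∎
    where
    cancel : ∀ x y → (1# + x) - (1# + y) ≈ x - y
    cancel x y = begin
      (1# + x) - (1# + y)       ≈⟨ +-congˡ (sym (-‿+-comm 1# y)) ⟩
      (1# + x) + (- 1# + - y)   ≈⟨ +-assoc 1# x _ ⟩
      1# + (x + (- 1# + - y))   ≈⟨ +-congˡ (trans (sym (+-assoc x _ _)) (+-congʳ (+-comm x _))) ⟩
      1# + ((- 1# + x) + - y)   ≈⟨ +-congˡ (+-assoc _ _ _) ⟩
      1# + (- 1# + (x - y))     ≈⟨ sym (+-assoc _ _ _) ⟩
      (1# - 1#) + (x - y)       ≈⟨ +-congʳ (-‿inverseʳ 1#) ⟩
      0# + (x - y)              ≈⟨ +-identityˡ _ ⟩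
      x - y                     ∎

  fromℤ-+ : ∀ i j → fromℤ (i ℤ.+ j) ≈ fromℤ i + fromℤ j
  fromℤ-+ -[1+ m ] -[1+ n ] = begin
    - fromℕ (suc (suc (m ℕ.+ n)))        ≡⟨ ≡.cong (λ k → - fromℕ (suc k)) (ℕ.+-suc m n) ⟨
    - fromℕ (suc m ℕ.+ suc n)            ≈⟨ -‿cong (fromℕ-+ (suc m) (suc n)) ⟩
    - (fromℕ (suc m) + fromℕ (suc n))    ≈⟨ -‿+-comm _ _ ⟨
    - fromℕ (suc m) + - fromℕ (suc n)    ∎
  fromℤ-+ -[1+ m ] (ℤ.+ n)    = trans (fromℤ-⊖ n (suc m)) (+-comm _ _)
  fromℤ-+ (ℤ.+ m)    -[1+ n ] = fromℤ-⊖ m (suc n)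
  fromℤ-+ (ℤ.+ m)    (ℤ.+ n)    = fromℕ-+ m n

  fromℤ-neg : ∀ i → fromℤ (ℤ.- i) ≈ - fromℤ i
  fromℤ-neg (ℤ.+ zero)    = sym -0#≈0#
  fromℤ-neg (ℤ.+ suc n)   = refl
  fromℤ-neg -[1+ n ]    = sym (-‿involutive _)

  private
    signed : Sign → Carrier → Carrier
    signed Sign.+ x = x
    signed Sign.- x = - x

    fromℤ-◃ : ∀ s n → fromℤ (s ℤ.◃ n) ≈ signed s (fromℕ n)
    fromℤ-◃ Sign.+ zero    = refl
    fromℤ-◃ Sign.+ (suc n) = refl
    fromℤ-◃ Sign.- zero    = sym -0#≈0#
    fromℤ-◃ Sign.- (suc n) = refl

  fromℤ-* : ∀ i j → fromℤ (i ℤ.* j) ≈ fromℤ i * fromℤ j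
  fromℤ-* (ℤ.+ m)    (ℤ.+ n)    = trans (fromℤ-◃ Sign.+ (m ℕ.* n)) (fromℕ-* m n)
  fromℤ-* (ℤ.+ m)    -[1+ n ] =
    trans (fromℤ-◃ Sign.- (m ℕ.* suc n)) (trans (-‿cong (fromℕ-* m (suc n))) (-‿distribʳ-* _ _))
  fromℤ-* -[1+ m ] (ℤ.+ n)    =
    trans (fromℤ-◃ Sign.- (suc m ℕ.* n)) (trans (-‿cong (fromℕ-* (suc m) n)) (-‿distribˡ-* _ _))
  fromℤ-* -[1+ m ] -[1+ n ] = begin
    fromℤ (Sign.+ ℤ.◃ suc m ℕ.* suc n)     ≈⟨ fromℤ-◃ Sign.+ (suc m ℕ.* suc n) ⟩
    fromℕ (suc m ℕ.* suc n)                ≈⟨ fromℕ-* (suc m) (suc n) ⟩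
    fromℕ (suc m) * fromℕ (suc n)          ≈⟨ -‿involutive _ ⟨
    - - (fromℕ (suc m) * fromℕ (suc n))    ≈⟨ -‿cong (-‿distribˡ-* _ _) ⟩
    - (- fromℕ (suc m) * fromℕ (suc n))    ≈⟨ -‿distribʳ-* _ _ ⟩
    - fromℕ (suc m) * - fromℕ (suc n)      ∎

  private
    ring′ : AlmostCommutativeRing c ℓ
    ring′ = fromCommutativeRing R

    fromℤ-morphism : ℤ.+-*-rawRing -Raw-AlmostCommutative⟶ ring′
    fromℤ-morphism = record
      { ⟦_⟧    = fromℤ
      ; +-homo = fromℤ-+
      ; *-homo = fromℤ-*
      ; -‿homo = fromℤ-neg
      ; 0-homo = refl
      ; 1-homo = refl
      }

    fromℤ-equal? : ∀ i j → Maybe (fromℤ i ≈ fromℤ j)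
    fromℤ-equal? i j with i ℤ.≟ j
    ... | yes ≡.refl = just refl
    ... | no _     = nothing

  open import Algebra.Solver.Ring ℤ.+-*-rawRing ring′ fromℤ-morphism fromℤ-equal? public
    using (solve; _:=_; _:+_; _:*_; :-_; _:-_; con; Polynomial)

  κ : ∀ {n} → ℕ → Polynomial n
  κ k = con (ℤ.+ k)

  polynomials : ℕ → RawRing 0ℓ 0ℓ
  polynomials n = record
    { Carrier = Polynomial n
    ; _≈_     = _≡_
    ; _+_     = _:+_
    ; _*_     = _:*_
    ; -_      = :-_
    ; 0#      = κ 0
    ; 1#      = κ 1
    }

open ≡ using (_≢_; refl; sym; trans; cong; cong₂; subst; isEquivalence; module ≡-Reasoning)

toℕ : Bool → ℕ
toℕ true  = 1
toℕ false = 0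

toℕ-not : ∀ b → toℕ (not b) +ℕ toℕ b ≡ 1
toℕ-not true  = refl
toℕ-not false = refl

toℕ-∧ : ∀ b c → toℕ (b ∧ c) ≡ toℕ b *ℕ toℕ c
toℕ-∧ true  c = sym (ℕ.+-identityʳ (toℕ c))
toℕ-∧ false c = refl

∧-absorbˡ : ∀ b c → (c ≡ true → b ≡ true) → b ∧ c ≡ c
∧-absorbˡ b true  c⇒b = trans (Bool.∧-identityʳ b) (c⇒b refl)
∧-absorbˡ b false _   = Bool.∧-zeroʳ b

∧-guarded-swap : ∀ b c d → (c ≡ true → b ≡ d) → b ∧ c ≡ c ∧ d
∧-guarded-swap b true  d c⇒b≡d = trans (Bool.∧-identityʳ b) (c⇒b≡d refl)
∧-guarded-swap b false d _     = Bool.∧-zeroʳ b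

∑ : {A : Set} → List A → (A → ℕ) → ℕ
∑ []       f = 0
∑ (x ∷ xs) f = f x +ℕ ∑ xs f

syntax ∑ xs (λ x → e) = ∑[ x ← xs ] e

module _ {A : Set} where

  count≡∑ : (p : A → Bool) (xs : List A) → count p xs ≡ ∑[ x ← xs ] toℕ (p x)
  count≡∑ p []       = refl
  count≡∑ p (x ∷ xs) with p x
  ... | true  = cong suc (count≡∑ p xs)
  ... | false = count≡∑ p xs

  ∑-cong : (xs : List A) {f g : A → ℕ} → (∀ x → f x ≡ g x) → ∑ xs f ≡ ∑ xs g
  ∑-cong []       f≗g = refl
  ∑-cong (x ∷ xs) f≗g = cong₂ _+ℕ_ (f≗g x) (∑-cong xs f≗g)

  ∑-+ : (xs : List A) (f g : A → ℕ) → ∑[ x ← xs ] (f x +ℕ g x) ≡ ∑ xs f +ℕ ∑ xs g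
  ∑-+ []       f g = refl
  ∑-+ (x ∷ xs) f g = begin
    (f x +ℕ g x) +ℕ ∑[ y ← xs ] (f y +ℕ g y)  ≡⟨ cong ((f x +ℕ g x) +ℕ_) (∑-+ xs f g) ⟩
    (f x +ℕ g x) +ℕ (∑ xs f +ℕ ∑ xs g)        ≡⟨ +-interchange (f x) (g x) _ _ ⟩
    (f x +ℕ ∑ xs f) +ℕ (g x +ℕ ∑ xs g)        ∎
    where open ≡-Reasoning

  ∑-*ˡ : (xs : List A) (c : ℕ) (f : A → ℕ) → ∑[ x ← xs ] (c *ℕ f x) ≡ c *ℕ ∑ xs f
  ∑-*ˡ []       c f = sym (ℕ.*-zeroʳ c)
  ∑-*ˡ (x ∷ xs) c f = trans (cong (c *ℕ f x +ℕ_) (∑-*ˡ xs c f)) (sym (ℕ.*-distribˡ-+ c (f x) _))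

  ∑-const : (xs : List A) (c : ℕ) → ∑[ _ ← xs ] c ≡ length xs *ℕ c
  ∑-const []       c = refl
  ∑-const (x ∷ xs) c = cong (c +ℕ_) (∑-const xs c)

  ∑-zero : (xs : List A) → ∑[ _ ← xs ] 0 ≡ 0
  ∑-zero []       = refl
  ∑-zero (x ∷ xs) = ∑-zero xs

  ∑-++ : (xs ys : List A) (f : A → ℕ) → ∑ (xs ++ ys) f ≡ ∑ xs f +ℕ ∑ ys f
  ∑-++ []       ys f = refl
  ∑-++ (x ∷ xs) ys f = trans (cong (f x +ℕ_) (∑-++ xs ys f)) (sym (ℕ.+-assoc (f x) _ _))

  ∑-≥ : (xs : List A) (f : A → ℕ) {a : A} → a ∈ xs → f a ℕ.≤ ∑ xs f
  ∑-≥ (x ∷ xs) f (here refl) = ℕ.m≤m+n (f x) _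
  ∑-≥ (x ∷ xs) f (there a∈)  = ℕ.≤-trans (∑-≥ xs f a∈) (ℕ.m≤n+m _ (f x))

  module _ (_≟_ : DecidableEquality A) where

    ∑-indicator-absent : (xs : List A) (a : A) → All (_≢ a) xs → ∑[ x ← xs ] toℕ (does (x ≟ a)) ≡ 0
    ∑-indicator-absent []       a []         = refl
    ∑-indicator-absent (x ∷ xs) a (x≢a ∷ ps) with x ≟ a
    ... | yes x≡a = ⊥-elim (x≢a x≡a)
    ... | no _    = ∑-indicator-absent xs a ps

    ∑-indicator : (xs : List A) (a : A) → Unique xs → a ∈ xs → ∑[ x ← xs ] toℕ (does (x ≟ a)) ≡ 1
    ∑-indicator (x ∷ xs) a (x∉xs ∷ _) (here refl) with x ≟ x
    ... | yes _   = cong suc (∑-indicator-absent xs x (All.map (λ x≢y y≡x → x≢y (sym y≡x)) x∉xs))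
    ... | no x≢x  = ⊥-elim (x≢x refl)
    ∑-indicator (x ∷ xs) a (x∉xs ∷ u) (there a∈) with x ≟ a
    ... | yes refl = ⊥-elim (All.lookup x∉xs a∈ refl)
    ... | no _     = ∑-indicator xs a u a∈

∑-map : {A B : Set} (g : A → B) (xs : List A) (f : B → ℕ) → ∑ (map g xs) f ≡ ∑[ x ← xs ] f (g x)
∑-map g []       f = refl
∑-map g (x ∷ xs) f = cong (f (g x) +ℕ_) (∑-map g xs f)

count-map : {A B : Set} (p : B → Bool) (f : A → B) (xs : List A) → count p (map f xs) ≡ count (λ x → p (f x)) xs
count-map p f xs = trans (count≡∑ p (map f xs)) (trans (∑-map f xs _) (sym (count≡∑ _ xs)))

∑-cartesianProduct : {A B : Set} (xs : List A) (ys : List B) (f : A × B → ℕ) →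
  ∑ (cartesianProduct xs ys) f ≡ ∑[ x ← xs ] ∑[ y ← ys ] f (x , y)
∑-cartesianProduct []       ys f = refl
∑-cartesianProduct (x ∷ xs) ys f =
  trans (∑-++ (map (x ,_) ys) _ f) (cong₂ _+ℕ_ (∑-map (x ,_) ys f) (∑-cartesianProduct xs ys f))

∑-comm : {A B : Set} (xs : List A) (ys : List B) (h : A → B → ℕ) →
  ∑[ x ← xs ] ∑[ y ← ys ] h x y ≡ ∑[ y ← ys ] ∑[ x ← xs ] h x y
∑-comm []       ys h = sym (∑-zero ys)
∑-comm (x ∷ xs) ys h =
  trans (cong (∑ ys (h x) +ℕ_) (∑-comm xs ys h)) (sym (∑-+ ys (h x) (λ y → ∑[ x′ ← xs ] h x′ y)))

does-cong : {P Q : Set} (p : Dec P) (q : Dec Q) → (P → Q) → (Q → P) → does p ≡ does q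
does-cong (yes _) (yes _) _   _   = refl
does-cong (yes p) (no ¬q) p→q _   = ⊥-elim (¬q (p→q p))
does-cong (no ¬p) (yes q) _   q→p = ⊥-elim (¬p (q→p q))
does-cong (no _)  (no _)  _   _   = refl


module FieldArithmetic (K : FiniteField) where
  open FiniteField K

  commutativeRing : CommutativeRing 0ℓ 0ℓ
  commutativeRing = record { isCommutativeRing = isCommutativeRing }

  open CommutativeRing commutativeRing public
    using (+-assoc; +-comm; *-assoc; *-comm; +-identityˡ; +-identityʳ; *-identityˡ; *-identityʳ;
           -‿inverseˡ; -‿inverseʳ; zeroˡ; zeroʳ)
  open IntegerCoefficientSolver commutativeRing public
  open import Algebra.Properties.Ring (CommutativeRing.ring commutativeRing) public
    using (-0#≈0#; -‿involutive) renaming (x∙y⁻¹≈ε⇒x≈y to x-y≡0⇒x≡y)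

  isZero : Carrier → Bool
  isZero x = does (x ≟ 0#)

  isZero-0# : isZero 0# ≡ true
  isZero-0# with 0# ≟ 0#
  ... | yes _   = refl
  ... | no 0≢0  = ⊥-elim (0≢0 refl)

  isZero-≢0 : ∀ {x} → x ≢ 0# → isZero x ≡ false
  isZero-≢0 {x} x≢0 with x ≟ 0#
  ... | yes x≡0 = ⊥-elim (x≢0 x≡0)
  ... | no _    = refl

  isZero⇒≡0 : ∀ {x} → isZero x ≡ true → x ≡ 0#
  isZero⇒≡0 {x} isZero-x with x ≟ 0#
  ... | yes x≡0 = x≡0

  -x≡0⇒x≡0 : ∀ {x} → - x ≡ 0# → x ≡ 0#
  -x≡0⇒x≡0 {x} -x≡0 = trans (sym (-‿involutive x)) (trans (cong -_ -x≡0) -0#≈0#)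

  isZero-neg : ∀ x → isZero (- x) ≡ isZero x
  isZero-neg x = does-cong ((- x) ≟ 0#) (x ≟ 0#) -x≡0⇒x≡0 (λ x≡0 → trans (cong -_ x≡0) -0#≈0#)

  module _ {x : Carrier} (x≢0 : x ≢ 0#) where

    x⁻¹ : Carrier
    x⁻¹ = proj₁ (inverse x x≢0)

    x*x⁻¹≡1 : x * x⁻¹ ≡ 1#
    x*x⁻¹≡1 = proj₂ (inverse x x≢0)

    *-cancelˡ : ∀ {y z} → x * y ≡ x * z → y ≡ z
    *-cancelˡ {y} {z} xy≡xz = begin
      y                   ≡⟨ *-identityˡ y ⟨
      1# * y              ≡⟨ cong (_* y) x*x⁻¹≡1 ⟨
      (x * x⁻¹) * y       ≡⟨ solve 3 (λ x x⁻¹ y → (x :* x⁻¹) :* y := x⁻¹ :* (x :* y)) refl x x⁻¹ y ⟩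
      x⁻¹ * (x * y)       ≡⟨ cong (x⁻¹ *_) xy≡xz ⟩
      x⁻¹ * (x * z)       ≡⟨ solve 3 (λ x x⁻¹ z → x⁻¹ :* (x :* z) := (x :* x⁻¹) :* z) refl x x⁻¹ z ⟩
      (x * x⁻¹) * z       ≡⟨ cong (_* z) x*x⁻¹≡1 ⟩
      1# * z              ≡⟨ *-identityˡ z ⟩
      z                   ∎
      where open ≡-Reasoning

  *-≢0 : ∀ {x y} → x ≢ 0# → y ≢ 0# → x * y ≢ 0#
  *-≢0 {x} {y} x≢0 y≢0 xy≡0 = y≢0 (*-cancelˡ x≢0 (trans xy≡0 (sym (zeroʳ x))))

  zero-product : ∀ x y → x * y ≡ 0# → x ≡ 0# ⊎ y ≡ 0#
  zero-product x y xy≡0 with x ≟ 0# | y ≟ 0#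
  ... | yes x≡0 | _       = inj₁ x≡0
  ... | _       | yes y≡0 = inj₂ y≡0
  ... | no x≢0  | no y≢0  = ⊥-elim (*-≢0 x≢0 y≢0 xy≡0)

  isZero-* : ∀ {l} x → l ≢ 0# → isZero (l * x) ≡ isZero x
  isZero-* {l} x l≢0 = does-cong ((l * x) ≟ 0#) (x ≟ 0#)
    (λ lx≡0 → *-cancelˡ l≢0 (trans lx≡0 (sym (zeroʳ l))))
    (λ x≡0 → trans (cong (l *_) x≡0) (zeroʳ l))

module FieldSums (K : FiniteField) where
  open FiniteField K
  open FieldArithmetic K

  ∑ᶠ : (Carrier → ℕ) → ℕ
  ∑ᶠ = ∑ elements

  syntax ∑ᶠ (λ x → e) = ∑ᶠ[ x ] e

  nonzero : Carrier → ℕ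
  nonzero x = toℕ (not (isZero x))

  δ : Carrier → Carrier → ℕ
  δ x a = toℕ (does (x ≟ a))

  ∑ᶠ-δ : ∀ a → ∑ᶠ[ x ] δ x a ≡ 1
  ∑ᶠ-δ a = ∑-indicator _≟_ elements a unique (complete a)

  ∑ᶠ-δ-* : ∀ a (f : Carrier → ℕ) → ∑ᶠ[ x ] (δ x a *ℕ f x) ≡ f a
  ∑ᶠ-δ-* a f = begin
    ∑ᶠ[ x ] (δ x a *ℕ f x)  ≡⟨ ∑-cong elements δ-swap ⟩
    ∑ᶠ[ x ] (f a *ℕ δ x a)  ≡⟨ ∑-*ˡ elements (f a) (λ x → δ x a) ⟩
    f a *ℕ ∑ᶠ[ x ] δ x a    ≡⟨ cong (f a *ℕ_) (∑ᶠ-δ a) ⟩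
    f a *ℕ 1                ≡⟨ ℕ.*-identityʳ (f a) ⟩
    f a                     ∎
    where
    open ≡-Reasoning
    δ-swap : ∀ x → δ x a *ℕ f x ≡ f a *ℕ δ x a
    δ-swap x with x ≟ a
    ... | yes refl = ℕ.*-comm 1 (f x)
    ... | no _     = sym (ℕ.*-zeroʳ (f a))

  ∑ᶠ-1 : ∑ᶠ[ _ ] 1 ≡ order
  ∑ᶠ-1 = trans (∑-const elements 1) (ℕ.*-identityʳ _)

  ∑ᶠ-bijection : (g h : Carrier → Carrier) → (∀ x → h (g x) ≡ x) → (∀ y → g (h y) ≡ y) →
    (f : Carrier → ℕ) → ∑ᶠ[ x ] f (g x) ≡ ∑ᶠ f
  ∑ᶠ-bijection g h hg gh f = begin
    ∑ᶠ[ x ] f (g x)                         ≡⟨ ∑-cong elements (λ x → sym (∑ᶠ-δ-* (g x) f)) ⟩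
    ∑ᶠ[ x ] ∑ᶠ[ y ] (δ y (g x) *ℕ f y)      ≡⟨ ∑-comm elements elements _ ⟩
    ∑ᶠ[ y ] ∑ᶠ[ x ] (δ y (g x) *ℕ f y)      ≡⟨ ∑-cong elements (λ y → ∑-cong elements (λ x →
                                                 cong (_*ℕ f y) (δ-inverse x y))) ⟩
    ∑ᶠ[ y ] ∑ᶠ[ x ] (δ x (h y) *ℕ f y)      ≡⟨ ∑-cong elements (λ y → ∑ᶠ-δ-* (h y) (λ _ → f y)) ⟩
    ∑ᶠ f                                    ∎
    where
    open ≡-Reasoning
    δ-inverse : ∀ x y → δ y (g x) ≡ δ x (h y)
    δ-inverse x y = cong toℕ (does-cong (y ≟ g x) (x ≟ h y)
      (λ y≡gx → trans (sym (hg x)) (cong h (sym y≡gx)))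
      (λ x≡hy → trans (sym (gh y)) (cong g (sym x≡hy))))

  ∑ᶠ-split-0# : (f : Carrier → ℕ) → ∑ᶠ f ≡ f 0# +ℕ ∑ᶠ[ x ] (nonzero x *ℕ f x)
  ∑ᶠ-split-0# f = begin
    ∑ᶠ f                                                      ≡⟨ ∑-cong elements split ⟨
    ∑ᶠ[ x ] (δ x 0# *ℕ f x +ℕ nonzero x *ℕ f x)               ≡⟨ ∑-+ elements _ _ ⟩
    ∑ᶠ[ x ] (δ x 0# *ℕ f x) +ℕ ∑ᶠ[ x ] (nonzero x *ℕ f x)     ≡⟨ cong (_+ℕ ∑ᶠ[ x ] (nonzero x *ℕ f x)) (∑ᶠ-δ-* 0# f) ⟩
    f 0# +ℕ ∑ᶠ[ x ] (nonzero x *ℕ f x)                        ∎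
    where
    open ≡-Reasoning
    split : ∀ x → δ x 0# *ℕ f x +ℕ nonzero x *ℕ f x ≡ f x
    split x = begin
      δ x 0# *ℕ f x +ℕ nonzero x *ℕ f x  ≡⟨ ℕ.*-distribʳ-+ (f x) (δ x 0#) (nonzero x) ⟨
      (δ x 0# +ℕ nonzero x) *ℕ f x       ≡⟨ cong (_*ℕ f x) (trans (ℕ.+-comm (δ x 0#) _) (toℕ-not (isZero x))) ⟩
      1 *ℕ f x                           ≡⟨ ℕ.*-identityˡ (f x) ⟩
      f x                                ∎

  ∑ᶠ-nonzero : ∑ᶠ nonzero ≡ order ∸ 1
  ∑ᶠ-nonzero = begin
    ∑ᶠ nonzero                       ≡⟨ ℕ.m+n∸m≡n 1 _ ⟨
    (1 +ℕ ∑ᶠ nonzero) ∸ 1            ≡⟨ cong (λ s → (1 +ℕ s) ∸ 1) (∑-cong elements (λ x → ℕ.*-identityʳ (nonzero x))) ⟨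
    (1 +ℕ ∑ᶠ[ x ] (nonzero x *ℕ 1)) ∸ 1 ≡⟨ cong (_∸ 1) (∑ᶠ-split-0# (λ _ → 1)) ⟨
    ∑ᶠ[ _ ] 1 ∸ 1                    ≡⟨ cong (_∸ 1) ∑ᶠ-1 ⟩
    order ∸ 1                        ∎
    where open ≡-Reasoning

  ∑ᶠ-nonzero-const : (f : Carrier → ℕ) (c : ℕ) → (∀ x → x ≢ 0# → f x ≡ c) →
    ∑ᶠ[ x ] (nonzero x *ℕ f x) ≡ (order ∸ 1) *ℕ c
  ∑ᶠ-nonzero-const f c f≡c = begin
    ∑ᶠ[ x ] (nonzero x *ℕ f x)   ≡⟨ ∑-cong elements on-nonzero ⟩
    ∑ᶠ[ x ] (c *ℕ nonzero x)     ≡⟨ ∑-*ˡ elements c nonzero ⟩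
    c *ℕ ∑ᶠ nonzero              ≡⟨ cong (c *ℕ_) ∑ᶠ-nonzero ⟩
    c *ℕ (order ∸ 1)             ≡⟨ ℕ.*-comm c _ ⟩
    (order ∸ 1) *ℕ c             ∎
    where
    open ≡-Reasoning
    on-nonzero : ∀ x → nonzero x *ℕ f x ≡ c *ℕ nonzero x
    on-nonzero x with x ≟ 0#
    ... | yes _   = sym (ℕ.*-zeroʳ c)
    ... | no x≢0  = trans (ℕ.+-identityʳ (f x)) (trans (f≡c x x≢0) (sym (ℕ.*-identityʳ c)))

  1≤order∸1 : 1 ℕ.≤ order ∸ 1
  1≤order∸1 = subst (1 ℕ.≤_) ∑ᶠ-nonzero (subst (ℕ._≤ ∑ᶠ nonzero) nonzero-1# (∑-≥ elements nonzero (complete 1#)))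
    where
    nonzero-1# : nonzero 1# ≡ 1
    nonzero-1# = cong (λ b → toℕ (not b)) (isZero-≢0 (λ 1≡0 → 0≢1 (sym 1≡0)))

  *-cancel-order∸1 : ∀ {m n} → (order ∸ 1) *ℕ m ≡ (order ∸ 1) *ℕ n → m ≡ n
  *-cancel-order∸1 {m} {n} eq with order ∸ 1 | 1≤order∸1
  ... | suc k | _ = ℕ.*-cancelˡ-≡ m n (suc k) eq

  ∑ᶠ-* : ∀ {l} → l ≢ 0# → (f : Carrier → ℕ) → ∑ᶠ[ x ] f (l * x) ≡ ∑ᶠ f
  ∑ᶠ-* {l} l≢0 = ∑ᶠ-bijection (l *_) (l⁻¹ *_) cancel cancel′
    where
    l⁻¹ = x⁻¹ l≢0
    cancel : ∀ x → l⁻¹ * (l * x) ≡ x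
    cancel x = trans (solve 3 (λ l l⁻¹ x → l⁻¹ :* (l :* x) := (l :* l⁻¹) :* x) refl l l⁻¹ x)
                     (trans (cong (_* x) (x*x⁻¹≡1 l≢0)) (*-identityˡ x))
    cancel′ : ∀ x → l * (l⁻¹ * x) ≡ x
    cancel′ x = trans (sym (*-assoc l l⁻¹ x)) (trans (cong (_* x) (x*x⁻¹≡1 l≢0)) (*-identityˡ x))

  ∑ᶠ-+ : ∀ c (f : Carrier → ℕ) → ∑ᶠ[ x ] f (x + c) ≡ ∑ᶠ f
  ∑ᶠ-+ c = ∑ᶠ-bijection (_+ c) (_- c)
    (λ x → solve 2 (λ x c → (x :+ c) :- c := x) refl x c)
    (λ x → solve 2 (λ x c → (x :- c) :+ c := x) refl x c)

  private
    ∑ᶠ-linear-system-L₂≢0 : ∀ {L₂} L₁ w₁ w₂ → L₂ ≢ 0# →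
      ∑ᶠ[ Y ] toℕ (does ((Y * L₁) ≟ w₁) ∧ does ((Y * L₂) ≟ w₂)) ≡ toℕ (isZero (w₂ * L₁ - w₁ * L₂))
    ∑ᶠ-linear-system-L₂≢0 {L₂} L₁ w₁ w₂ L₂≢0 = begin
      ∑ᶠ[ Y ] toℕ (does ((Y * L₁) ≟ w₁) ∧ does ((Y * L₂) ≟ w₂))
        ≡⟨ ∑-cong elements (λ Y → trans (toℕ-∧ (does ((Y * L₁) ≟ w₁)) _) (trans (cong (λ b → toℕ (does ((Y * L₁) ≟ w₁)) *ℕ toℕ b) (unique-solution Y))
                                                         (ℕ.*-comm (toℕ (does ((Y * L₁) ≟ w₁))) (δ Y Y₀)))) ⟩
      ∑ᶠ[ Y ] (δ Y Y₀ *ℕ toℕ (does ((Y * L₁) ≟ w₁)))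
        ≡⟨ ∑ᶠ-δ-* Y₀ (λ Y → toℕ (does ((Y * L₁) ≟ w₁))) ⟩
      toℕ (does ((Y₀ * L₁) ≟ w₁))
        ≡⟨ cong toℕ (does-cong ((Y₀ * L₁) ≟ w₁) ((w₂ * L₁ - w₁ * L₂) ≟ 0#) consistent consistent⁻¹) ⟩
      toℕ (isZero (w₂ * L₁ - w₁ * L₂)) ∎
      where
      open ≡-Reasoning
      Y₀ = w₂ * x⁻¹ L₂≢0
      Y₀L₂≡w₂ : Y₀ * L₂ ≡ w₂
      Y₀L₂≡w₂ = trans (solve 3 (λ w i L → w :* i :* L := w :* (L :* i)) refl w₂ (x⁻¹ L₂≢0) L₂)
                      (trans (cong (w₂ *_) (x*x⁻¹≡1 L₂≢0)) (*-identityʳ w₂))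
      unique-solution : ∀ Y → does ((Y * L₂) ≟ w₂) ≡ does (Y ≟ Y₀)
      unique-solution Y = does-cong ((Y * L₂) ≟ w₂) (Y ≟ Y₀)
        (λ YL₂≡w₂ → *-cancelˡ L₂≢0 (trans (*-comm L₂ Y) (trans YL₂≡w₂ (trans (sym Y₀L₂≡w₂) (*-comm Y₀ L₂)))))
        (λ Y≡Y₀ → trans (cong (_* L₂) Y≡Y₀) Y₀L₂≡w₂)
      consistent : Y₀ * L₁ ≡ w₁ → w₂ * L₁ - w₁ * L₂ ≡ 0#
      consistent Y₀L₁≡w₁ = begin
        w₂ * L₁ - w₁ * L₂                 ≡⟨ cong₂ (λ u v → u * L₁ - v * L₂) (sym Y₀L₂≡w₂) (sym Y₀L₁≡w₁) ⟩
        Y₀ * L₂ * L₁ - Y₀ * L₁ * L₂       ≡⟨ solve 3 (λ y a b → y :* b :* a :- y :* a :* b := κ 0) refl Y₀ L₁ L₂ ⟩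
        0#                                ∎
      consistent⁻¹ : w₂ * L₁ - w₁ * L₂ ≡ 0# → Y₀ * L₁ ≡ w₁
      consistent⁻¹ eq = *-cancelˡ L₂≢0 (begin
        L₂ * (Y₀ * L₁)     ≡⟨ solve 3 (λ y a b → b :* (y :* a) := y :* b :* a) refl Y₀ L₁ L₂ ⟩
        Y₀ * L₂ * L₁       ≡⟨ cong (_* L₁) Y₀L₂≡w₂ ⟩
        w₂ * L₁            ≡⟨ x-y≡0⇒x≡y _ _ eq ⟩
        w₁ * L₂            ≡⟨ *-comm w₁ L₂ ⟩
        L₂ * w₁            ∎)

  ∑ᶠ-linear-system : ∀ L₁ L₂ w₁ w₂ → ¬ (L₁ ≡ 0# × L₂ ≡ 0#) →
    ∑ᶠ[ Y ] toℕ (does ((Y * L₁) ≟ w₁) ∧ does ((Y * L₂) ≟ w₂)) ≡ toℕ (isZero (w₂ * L₁ - w₁ * L₂))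
  ∑ᶠ-linear-system L₁ L₂ w₁ w₂ L≢0 with L₁ ≟ 0# | L₂ ≟ 0#
  ... | _        | no L₂≢0 = ∑ᶠ-linear-system-L₂≢0 L₁ w₁ w₂ L₂≢0
  ... | yes L₁≡0 | yes L₂≡0 = ⊥-elim (L≢0 (L₁≡0 , L₂≡0))
  ... | no L₁≢0  | yes _    = begin
    ∑ᶠ[ Y ] toℕ (does ((Y * L₁) ≟ w₁) ∧ does ((Y * L₂) ≟ w₂))
      ≡⟨ ∑-cong elements (λ Y → cong toℕ (Bool.∧-comm (does ((Y * L₁) ≟ w₁)) _)) ⟩
    ∑ᶠ[ Y ] toℕ (does ((Y * L₂) ≟ w₂) ∧ does ((Y * L₁) ≟ w₁))
      ≡⟨ ∑ᶠ-linear-system-L₂≢0 L₂ w₂ w₁ L₁≢0 ⟩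
    toℕ (isZero (w₁ * L₂ - w₂ * L₁))
      ≡⟨ cong (λ x → toℕ (isZero x)) (solve 4 (λ a b u v → u :* b :- v :* a := :- (v :* a :- u :* b)) refl L₁ L₂ w₁ w₂) ⟩
    toℕ (isZero (- (w₂ * L₁ - w₁ * L₂)))
      ≡⟨ cong toℕ (isZero-neg _) ⟩
    toℕ (isZero (w₂ * L₁ - w₁ * L₂)) ∎
    where open ≡-Reasoning

  private
    position : List Carrier → Carrier → ℕ
    position []       x = 0
    position (y ∷ ys) x with y ≟ x
    ... | yes _ = 0
    ... | no _  = suc (position ys x)

    position-injective : ∀ xs {x y} → x ∈ xs → y ∈ xs → position xs x ≡ position xs y → x ≡ y
    position-injective (z ∷ zs) {x} {y} x∈ y∈ eq with z ≟ x | z ≟ y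
    ... | yes refl | yes refl = refl
    ... | no z≢x   | no z≢y   = position-injective zs (tail z≢x x∈) (tail z≢y y∈) (ℕ.suc-injective eq)
      where
      tail : ∀ {w} → z ≢ w → w ∈ z ∷ zs → w ∈ zs
      tail z≢w (here refl) = ⊥-elim (z≢w refl)
      tail z≢w (there w∈) = w∈

    <ᵇ-either : ∀ i j → i ≢ j → toℕ (i ℕ.<ᵇ j) +ℕ toℕ (j ℕ.<ᵇ i) ≡ 1
    <ᵇ-either zero    zero    i≢j = ⊥-elim (i≢j refl)
    <ᵇ-either zero    (suc j) _   = refl
    <ᵇ-either (suc i) zero    _   = refl
    <ᵇ-either (suc i) (suc j) i≢j = <ᵇ-either i j (λ i≡j → i≢j (cong suc i≡j))

  -- In characteristic 2, x ↦ x + 1 is a fixed-point-free involution; choosing in each orbit the element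
  -- listed first in elements exhibits order as twice a number.
  odd-order⇒2≢0 : (∃ λ k → order ≡ suc (k +ℕ k)) → 2# ≢ 0#
  odd-order⇒2≢0 (k , order≡2k+1) 2≡0 = ℕ.even≢odd (∑ᶠ first) k (begin
    ∑ᶠ first +ℕ (∑ᶠ first +ℕ 0)              ≡⟨ cong (∑ᶠ first +ℕ_) (ℕ.+-identityʳ _) ⟩
    ∑ᶠ first +ℕ ∑ᶠ first                     ≡⟨ cong (∑ᶠ first +ℕ_) (∑ᶠ-+ 1# first) ⟨
    ∑ᶠ first +ℕ ∑ᶠ[ x ] first (σ x)          ≡⟨ ∑-+ elements first (λ x → first (σ x)) ⟨
    ∑ᶠ[ x ] (first x +ℕ first (σ x))         ≡⟨ ∑-cong elements orbit ⟩
    ∑ᶠ[ _ ] 1                                ≡⟨ ∑ᶠ-1 ⟩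
    order                                    ≡⟨ order≡2k+1 ⟩
    suc (k +ℕ k)                             ≡⟨ cong (λ n → suc (k +ℕ n)) (ℕ.+-identityʳ k) ⟨
    suc (k +ℕ (k +ℕ 0))                      ∎)
    where
    open ≡-Reasoning
    σ : Carrier → Carrier
    σ x = x + 1#
    σσ : ∀ x → σ (σ x) ≡ x
    σσ x = trans (+-assoc x 1# 1#) (trans (cong (x +_) 2≡0) (+-identityʳ x))
    σ-no-fixpoint : ∀ x → σ x ≢ x
    σ-no-fixpoint x σx≡x = 0≢1 (sym (trans (solve 2 (λ x o → o := (x :+ o) :- x) refl x 1#)
                                          (trans (cong (_- x) σx≡x) (-‿inverseʳ x))))
    first : Carrier → ℕ
    first x = toℕ (position elements x ℕ.<ᵇ position elements (σ x))
    orbit : ∀ x → first x +ℕ first (σ x) ≡ 1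
    orbit x = trans (cong (λ y → first x +ℕ toℕ (position elements (σ x) ℕ.<ᵇ position elements y)) (σσ x))
                    (<ᵇ-either _ _ (λ eq → σ-no-fixpoint x (sym (position-injective elements (complete x) (complete (σ x)) eq))))

module ProjectiveCounting (K : FiniteField) where
  open FiniteField K
  open FieldArithmetic K
  open FieldSums K

  -- coordinate vectors of length n + 1, nested to the right as in F × F × F
  Vector : ℕ → Set
  Vector zero    = Carrier
  Vector (suc n) = Carrier × Vector n

  vectors : ∀ n → List (Vector n)
  vectors zero    = elements
  vectors (suc n) = cartesianProduct elements (vectors n)

  ∑ᵛ : ∀ n → (Vector n → ℕ) → ℕ
  ∑ᵛ zero    f = ∑ᶠ f
  ∑ᵛ (suc n) f = ∑ᶠ[ x ] ∑ᵛ n (λ v → f (x , v))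

  ∑ᵛ-cong : ∀ n {f g : Vector n → ℕ} → (∀ v → f v ≡ g v) → ∑ᵛ n f ≡ ∑ᵛ n g
  ∑ᵛ-cong zero    f≗g = ∑-cong elements f≗g
  ∑ᵛ-cong (suc n) f≗g = ∑-cong elements (λ x → ∑ᵛ-cong n (λ v → f≗g (x , v)))

  ∑ᵛ-+ : ∀ n (f g : Vector n → ℕ) → ∑ᵛ n (λ v → f v +ℕ g v) ≡ ∑ᵛ n f +ℕ ∑ᵛ n g
  ∑ᵛ-+ zero    f g = ∑-+ elements f g
  ∑ᵛ-+ (suc n) f g = trans (∑-cong elements (λ x → ∑ᵛ-+ n (λ v → f (x , v)) (λ v → g (x , v)))) (∑-+ elements _ _)

  ∑ᵛ-*ˡ : ∀ n c (f : Vector n → ℕ) → ∑ᵛ n (λ v → c *ℕ f v) ≡ c *ℕ ∑ᵛ n f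
  ∑ᵛ-*ˡ zero    c f = ∑-*ˡ elements c f
  ∑ᵛ-*ˡ (suc n) c f = trans (∑-cong elements (λ x → ∑ᵛ-*ˡ n c (λ v → f (x , v)))) (∑-*ˡ elements c _)

  ∑-vectors : ∀ n (f : Vector n → ℕ) → ∑ (vectors n) f ≡ ∑ᵛ n f
  ∑-vectors zero    f = refl
  ∑-vectors (suc n) f = trans (∑-cartesianProduct elements (vectors n) f)
                              (∑-cong elements (λ x → ∑-vectors n (λ v → f (x , v))))

  isZeroᵛ : ∀ n → Vector n → Bool
  isZeroᵛ zero    x       = isZero x
  isZeroᵛ (suc n) (x , v) = isZero x ∧ isZeroᵛ n v

  nonzeroᵛ : ∀ n → Vector n → ℕ
  nonzeroᵛ n v = toℕ (not (isZeroᵛ n v))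

  scale : ∀ n → Carrier → Vector n → Vector n
  scale zero    l x       = l * x
  scale (suc n) l (x , v) = l * x , scale n l v

  ∑ᵛ-scale : ∀ n {l} → l ≢ 0# → (f : Vector n → ℕ) → ∑ᵛ n (λ v → f (scale n l v)) ≡ ∑ᵛ n f
  ∑ᵛ-scale zero    l≢0 f = ∑ᶠ-* l≢0 f
  ∑ᵛ-scale (suc n) {l} l≢0 f = trans (∑-cong elements (λ x → ∑ᵛ-scale n l≢0 (λ v → f (l * x , v))))
                                 (∑ᶠ-* l≢0 (λ x → ∑ᵛ n (λ v → f (x , v))))

  projectivePoints : ∀ n → List (Vector n)
  projectivePoints zero    = 1# ∷ []
  projectivePoints (suc n) = map (1# ,_) (vectors n) ++ map (0# ,_) (projectivePoints n)

  Homogeneous : ∀ n → (Vector n → ℕ) → Set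
  Homogeneous n f = ∀ {l} v → l ≢ 0# → f (scale n l v) ≡ f v

  ∑-projectivePoints : ∀ n (f : Vector n → ℕ) → Homogeneous n f →
    (order ∸ 1) *ℕ ∑ (projectivePoints n) f ≡ ∑ᵛ n (λ v → nonzeroᵛ n v *ℕ f v)
  ∑-projectivePoints zero f hom = begin
    (order ∸ 1) *ℕ (f 1# +ℕ 0)       ≡⟨ cong ((order ∸ 1) *ℕ_) (ℕ.+-identityʳ (f 1#)) ⟩
    (order ∸ 1) *ℕ f 1#              ≡⟨ ∑ᶠ-nonzero-const f (f 1#) (λ x x≢0 →
                                          trans (cong f (sym (*-identityʳ x))) (hom 1# x≢0)) ⟨
    ∑ᶠ[ x ] (nonzero x *ℕ f x)       ∎
    where open ≡-Reasoning
  ∑-projectivePoints (suc n) f hom = begin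
    q-1 *ℕ ∑ (map (1# ,_) (vectors n) ++ map (0# ,_) (projectivePoints n)) f
      ≡⟨ cong (q-1 *ℕ_) (trans (∑-++ (map (1# ,_) (vectors n)) _ f) (cong₂ _+ℕ_ (∑-map _ (vectors n) f) (∑-map _ (projectivePoints n) f))) ⟩
    q-1 *ℕ (∑ (vectors n) (λ v → f (1# , v)) +ℕ ∑ (projectivePoints n) (λ v → f (0# , v)))
      ≡⟨ ℕ.*-distribˡ-+ q-1 _ _ ⟩
    q-1 *ℕ ∑ (vectors n) (λ v → f (1# , v)) +ℕ q-1 *ℕ ∑ (projectivePoints n) (λ v → f (0# , v))
      ≡⟨ cong₂ _+ℕ_ (cong (q-1 *ℕ_) (∑-vectors n _)) (∑-projectivePoints n _ hom₀) ⟩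
    q-1 *ℕ ∑ᵛ n (λ v → f (1# , v)) +ℕ ∑ᵛ n (λ v → nonzeroᵛ n v *ℕ f (0# , v))
      ≡⟨ cong₂ _+ℕ_ (sym (∑ᶠ-nonzero-const _ _ affine)) (∑ᵛ-cong n at-0#) ⟩
    ∑ᶠ[ t ] (nonzero t *ℕ ∑ᵛ n (λ v → f (t , v))) +ℕ ∑ᵛ n (λ v → nonzeroᵛ (suc n) (0# , v) *ℕ f (0# , v))
      ≡⟨ ℕ.+-comm (∑ᶠ[ t ] (nonzero t *ℕ ∑ᵛ n (λ v → f (t , v)))) _ ⟩
    ∑ᵛ n (λ v → nonzeroᵛ (suc n) (0# , v) *ℕ f (0# , v)) +ℕ ∑ᶠ[ t ] (nonzero t *ℕ ∑ᵛ n (λ v → f (t , v)))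
      ≡⟨ cong (∑ᵛ n (λ v → nonzeroᵛ (suc n) (0# , v) *ℕ f (0# , v)) +ℕ_) (∑-cong elements off-0#) ⟩
    ∑ᵛ n (λ v → nonzeroᵛ (suc n) (0# , v) *ℕ f (0# , v))
      +ℕ ∑ᶠ[ t ] (nonzero t *ℕ ∑ᵛ n (λ v → nonzeroᵛ (suc n) (t , v) *ℕ f (t , v)))
      ≡⟨ ∑ᶠ-split-0# (λ t → ∑ᵛ n (λ v → nonzeroᵛ (suc n) (t , v) *ℕ f (t , v))) ⟨
    ∑ᵛ (suc n) (λ v → nonzeroᵛ (suc n) v *ℕ f v) ∎
    where
    open ≡-Reasoning
    q-1 = order ∸ 1
    hom₀ : Homogeneous n (λ v → f (0# , v))
    hom₀ {l} v l≢0 = trans (cong (λ x → f (x , scale n l v)) (sym (zeroʳ l))) (hom (0# , v) l≢0)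
    affine : ∀ t → t ≢ 0# → ∑ᵛ n (λ v → f (t , v)) ≡ ∑ᵛ n (λ v → f (1# , v))
    affine t t≢0 = begin
      ∑ᵛ n (λ v → f (t , v))         ≡⟨ ∑ᵛ-scale n t≢0 (λ v → f (t , v)) ⟨
      ∑ᵛ n (λ v → f (t , scale n t v))     ≡⟨ ∑ᵛ-cong n (λ v → cong (λ x → f (x , scale n t v)) (sym (*-identityʳ t))) ⟩
      ∑ᵛ n (λ v → f (scale (suc n) t (1# , v)))  ≡⟨ ∑ᵛ-cong n (λ v → hom (1# , v) t≢0) ⟩
      ∑ᵛ n (λ v → f (1# , v))        ∎
    at-0# : ∀ v → nonzeroᵛ n v *ℕ f (0# , v) ≡ nonzeroᵛ (suc n) (0# , v) *ℕ f (0# , v)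
    at-0# v = cong (λ b → toℕ (not (b ∧ isZeroᵛ n v)) *ℕ f (0# , v)) (sym isZero-0#)
    off-0# : ∀ t → nonzero t *ℕ ∑ᵛ n (λ v → f (t , v))
                 ≡ nonzero t *ℕ ∑ᵛ n (λ v → nonzeroᵛ (suc n) (t , v) *ℕ f (t , v))
    off-0# t with t ≟ 0#
    ... | yes _ = refl
    ... | no _  = cong (λ s → s +ℕ 0) (∑ᵛ-cong n (λ v → sym (ℕ.+-identityʳ (f (t , v)))))

  count-projectivePoints : ∀ n (p : Vector n → Bool) → Homogeneous n (λ v → toℕ (p v)) →
    (order ∸ 1) *ℕ count p (projectivePoints n) ≡ ∑ᵛ n (λ v → nonzeroᵛ n v *ℕ toℕ (p v))
  count-projectivePoints n p hom =
    trans (cong ((order ∸ 1) *ℕ_) (count≡∑ p (projectivePoints n)))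
          (∑-projectivePoints n (λ v → toℕ (p v)) hom)

  PG2≡projectivePoints : PG2 0# 1# elements ≡ projectivePoints 2
  PG2≡projectivePoints = cong (map (1# ,_) (vectors 1) ++_) (sym (begin
    map (0# ,_) (map (1# ,_) elements ++ (0# , 1#) ∷ [])
      ≡⟨ List.map-++ (0# ,_) (map (1# ,_) elements) _ ⟩
    map (0# ,_) (map (1# ,_) elements) ++ (0# , 0# , 1#) ∷ []
      ≡⟨ cong (_++ (0# , 0# , 1#) ∷ []) (List.map-∘ elements) ⟨
    map (λ w → 0# , 1# , w) elements ++ (0# , 0# , 1#) ∷ [] ∎))
    where open ≡-Reasoning

  PG3≡projectivePoints : PG3 0# 1# elements ≡ projectivePoints 3
  PG3≡projectivePoints = cong (map (1# ,_) (vectors 2) ++_) (sym (begin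
    map (0# ,_) (map (1# ,_) (vectors 1) ++ map (0# ,_) (projectivePoints 1))
      ≡⟨ List.map-++ (0# ,_) (map (1# ,_) (vectors 1)) _ ⟩
    map (0# ,_) (map (1# ,_) (vectors 1)) ++ map (0# ,_) (map (0# ,_) (projectivePoints 1))
      ≡⟨ cong (map (0# ,_) (map (1# ,_) (vectors 1)) ++_) (trans (sym (List.map-∘ (projectivePoints 1))) (List.map-++ (λ w → 0# , 0# , w) (map (1# ,_) elements) _)) ⟩
    map (0# ,_) (map (1# ,_) (vectors 1)) ++ map (λ w → 0# , 0# , w) (map (1# ,_) elements) ++ (0# , 0# , 0# , 1#) ∷ []
      ≡⟨ cong₂ (λ xs ys → xs ++ ys ++ (0# , 0# , 0# , 1#) ∷ []) (List.map-∘ (vectors 1)) (List.map-∘ elements) ⟨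
    map (λ { (y , w) → 0# , 1# , y , w }) (vectors 1) ++ map (λ w → 0# , 0# , 1# , w) elements ++ (0# , 0# , 0# , 1#) ∷ [] ∎))
    where open ≡-Reasoning

record Ternary (A : Set) : Set where
  constructor ternary
  field xx yy zz xy xz yz : A

-- Stated over an arbitrary raw ring so that the same expressions can be instantiated both in a
-- field and in the ring of solver polynomials, where the identities below are checked.
module QuadraticFormAlgebra (R : RawRing 0ℓ 0ℓ) where
  open RawRing R

  infixl 6 _-_
  _-_ : Carrier → Carrier → Carrier
  x - y = x + - y

  2# : Carrier
  2# = 1# + 1#

  Point : Set
  Point = Carrier × Carrier × Carrier

  binary : Carrier → Carrier → Carrier → Carrier → Carrier → Carrier
  binary α β γ y z = α * y * y + β * y * z + γ * z * z

  discriminant : Carrier → Carrier → Carrier → Carrier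
  discriminant α β γ = β * β - 2# * 2# * α * γ

  quadratic : Ternary Carrier → Point → Carrier
  quadratic (ternary a f e b c d) (x , y , z) =
    a * x * x + b * x * y + c * x * z + d * y * z + e * z * z + f * y * y

  -- the adjugate form: its matrix is the adjugate of [[2a,b,c],[b,2f,d],[c,d,2e]]
  dual : Ternary Carrier → Ternary Carrier
  dual (ternary a f e b c d) = ternary
    (2# * 2# * e * f - d * d) (2# * 2# * a * e - c * c) (2# * 2# * a * f - b * b)
    (2# * c * d - 2# * 2# * b * e) (2# * b * d - 2# * 2# * c * f) (2# * b * c - 2# * 2# * a * d)

  determinant : Ternary Carrier → Carrier
  determinant (ternary a f e b c d) =
    2# * 2# * 2# * a * e * f - 2# * a * d * d - 2# * b * b * e + 2# * b * c * d - 2# * c * c * f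

  dot : Point → Point → Carrier
  dot (u , v , w) (x , y , z) = u * x + v * y + w * z

  -- for u ≠ 0, (y , z) ↦ restrict (u , v , w) y z parametrises the plane orthogonal to (u , v , w)
  restrict : Point → Carrier → Carrier → Point
  restrict (u , v , w) y z = - (v * y + w * z) , u * y , u * z

  -- coefficients of the binary form (y , z) ↦ G (restrict ℓ y z), read off from three values
  restrictedCoefficients : (Point → Carrier) → Point → Carrier × Carrier × Carrier
  restrictedCoefficients G ℓ =
    let α = G (restrict ℓ 1# 0#)
        γ = G (restrict ℓ 0# 1#)
    in α , G (restrict ℓ 1# 1#) - α - γ , γ

  swap₁₂ swap₁₃ : Point → Point
  swap₁₂ (x , y , z) = y , x , z
  swap₁₃ (x , y , z) = z , y , x

  swap₁₂ᶜ swap₁₃ᶜ : Ternary Carrier → Ternary Carrier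
  swap₁₂ᶜ (ternary a f e b c d) = ternary f a e b d c
  swap₁₃ᶜ (ternary a f e b c d) = ternary e f a d c b

-- Ext's operations and Conic.form, restated over an arbitrary raw ring for the same purpose.
module QuadraticExtensionAlgebra (R : RawRing 0ℓ 0ℓ) (ω : RawRing.Carrier R) where
  open RawRing R

  infixl 6 _+₂_
  infixl 7 _*₂_

  _+₂_ : Carrier × Carrier → Carrier × Carrier → Carrier × Carrier
  (z₁ , z₂) +₂ (w₁ , w₂) = z₁ + w₁ , z₂ + w₂

  _*₂_ : Carrier × Carrier → Carrier × Carrier → Carrier × Carrier
  (z₁ , z₂) *₂ (w₁ , w₂) = z₁ * w₁ + ω * (z₂ * w₂) , z₁ * w₂ + z₂ * w₁

  conicForm : (a b c d e : Carrier × Carrier) → (Carrier × Carrier) × (Carrier × Carrier) × (Carrier × Carrier) → Carrier × Carrier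
  conicForm a b c d e (x , y , z) = a *₂ x *₂ x +₂ b *₂ x *₂ y +₂ c *₂ x *₂ z +₂ d *₂ y *₂ z +₂ e *₂ z *₂ z

module SquareRoots (K : FiniteField) where
  open FiniteField K
  open FieldArithmetic K
  open FieldSums K
  open ProjectiveCounting K using (∑ᵛ; nonzeroᵛ)
  open QuadraticFormAlgebra (CommutativeRing.rawRing commutativeRing) using (binary; discriminant)

  squareRoots : Carrier → ℕ
  squareRoots Δ = ∑ᶠ[ s ] δ (s * s) Δ

  squareRoots-0# : squareRoots 0# ≡ 1
  squareRoots-0# = trans (∑-cong elements (λ s → cong toℕ (does-cong ((s * s) ≟ 0#) (s ≟ 0#) s²≡0⇒s≡0
                                                                  (λ s≡0 → trans (cong (_* s) s≡0) (zeroˡ s)))))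
                         (∑ᶠ-δ 0#)
    where
    s²≡0⇒s≡0 : ∀ {s} → s * s ≡ 0# → s ≡ 0#
    s²≡0⇒s≡0 {s} s²≡0 with zero-product s s s²≡0
    ... | inj₁ s≡0 = s≡0
    ... | inj₂ s≡0 = s≡0

  squareRoots-* : ∀ {c} Δ → c ≢ 0# → squareRoots (c * c * Δ) ≡ squareRoots Δ
  squareRoots-* {c} Δ c≢0 = begin
    squareRoots (c * c * Δ)                 ≡⟨ ∑ᶠ-* c≢0 (λ s → δ (s * s) (c * c * Δ)) ⟨
    ∑ᶠ[ s ] δ ((c * s) * (c * s)) (c * c * Δ) ≡⟨ ∑-cong elements (λ s → cong toℕ (does-cong (_ ≟ _) (_ ≟ _)
                                                  (λ eq → *-cancelˡ (*-≢0 c≢0 c≢0) (trans (sym (expand s)) eq))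
                                                  (λ eq → trans (expand s) (cong ((c * c) *_) eq)))) ⟩
    squareRoots Δ                           ∎
    where
    open ≡-Reasoning
    expand : ∀ s → (c * s) * (c * s) ≡ c * c * (s * s)
    expand s = solve 2 (λ c s → (c :* s) :* (c :* s) := c :* c :* (s :* s)) refl c s

  squareRoots-nonsquare : ∀ Δ → (∀ s → s * s ≢ Δ) → squareRoots Δ ≡ 0
  squareRoots-nonsquare Δ nonsquare = trans (∑-cong elements no-root) (∑-zero elements)
    where
    no-root : ∀ s → δ (s * s) Δ ≡ 0
    no-root s with (s * s) ≟ Δ
    ... | yes s²≡Δ = ⊥-elim (nonsquare s s²≡Δ)
    ... | no _     = refl

  square? : ∀ Δ → isSquare Δ ⊎ (∀ s → s * s ≢ Δ)
  square? Δ with any? (λ s → (s * s) ≟ Δ) elements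
  ... | yes root = inj₁ (satisfied root)
  ... | no ¬root = inj₂ (λ s s²≡Δ → ¬root (lose (complete s) s²≡Δ))

  module OddCharacteristic (2≢0 : 2# ≢ 0#) where

    x≢-x : ∀ {x} → x ≢ 0# → x ≢ - x
    x≢-x {x} x≢0 x≡-x = *-≢0 2≢0 x≢0 (begin
      2# * x        ≡⟨ solve 1 (λ x → κ 2 :* x := x :+ x) refl x ⟩
      x + x         ≡⟨ cong (x +_) x≡-x ⟩
      x + - x       ≡⟨ -‿inverseʳ x ⟩
      0#            ∎)
      where open ≡-Reasoning

    square-roots : ∀ {s t} → s * s ≡ t * t → s ≡ t ⊎ s ≡ - t
    square-roots {s} {t} s²≡t² with zero-product (s - t) (s + t) (begin
      (s - t) * (s + t)   ≡⟨ solve 2 (λ s t → (s :- t) :* (s :+ t) := s :* s :- t :* t) refl s t ⟩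
      s * s - t * t       ≡⟨ cong (_- t * t) s²≡t² ⟩
      t * t - t * t       ≡⟨ -‿inverseʳ (t * t) ⟩
      0#                  ∎)
      where open ≡-Reasoning
    ... | inj₁ s-t≡0 = inj₁ (x-y≡0⇒x≡y s t s-t≡0)
    ... | inj₂ s+t≡0 = inj₂ (x-y≡0⇒x≡y s (- t) (trans (cong (s +_) (-‿involutive t)) s+t≡0))

    δ-square : ∀ {t} → t ≢ 0# → ∀ s → δ (s * s) (t * t) ≡ δ s t +ℕ δ s (- t)
    δ-square {t} t≢0 s with (s * s) ≟ (t * t) | s ≟ t | s ≟ (- t)
    ... | _       | yes refl | yes t≡-t = ⊥-elim (x≢-x t≢0 t≡-t)
    ... | yes _   | yes refl | no _     = refl
    ... | yes _   | no _     | yes _    = refl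
    ... | yes s²≡t² | no s≢t | no s≢-t with square-roots s²≡t²
    ...   | inj₁ s≡t  = ⊥-elim (s≢t s≡t)
    ...   | inj₂ s≡-t = ⊥-elim (s≢-t s≡-t)
    δ-square t≢0 s | no s²≢t² | yes refl | _        = ⊥-elim (s²≢t² refl)
    δ-square {t} t≢0 s | no s²≢t² | no _ | yes refl =
      ⊥-elim (s²≢t² (solve 1 (λ t → (:- t) :* (:- t) := t :* t) refl t))
    δ-square t≢0 s | no _     | no _     | no _     = refl

    squareRoots-square : ∀ {t} → t ≢ 0# → squareRoots (t * t) ≡ 2
    squareRoots-square {t} t≢0 =
      trans (∑-cong elements (δ-square t≢0)) (trans (∑-+ elements _ _) (cong₂ _+ℕ_ (∑ᶠ-δ t) (∑ᶠ-δ (- t))))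

    squareRoots-≢0 : ∀ {Δ} → Δ ≢ 0# → squareRoots Δ ≡ 0 ⊎ squareRoots Δ ≡ 2
    squareRoots-≢0 {Δ} Δ≢0 with square? Δ
    ... | inj₁ (s , refl) = inj₂ (squareRoots-square (λ s≡0 → Δ≢0 (trans (cong (λ x → x * x) s≡0) (zeroʳ 0#))))
    ... | inj₂ nonsquare  = inj₁ (squareRoots-nonsquare Δ nonsquare)

    squareRoots≡1⇒≡0 : ∀ {Δ} → squareRoots Δ ≡ 1 → Δ ≡ 0#
    squareRoots≡1⇒≡0 {Δ} roots≡1 with Δ ≟ 0#
    ... | yes Δ≡0 = Δ≡0
    ... | no Δ≢0 with squareRoots-≢0 Δ≢0
    ...   | inj₁ roots≡0 with () ← trans (sym roots≡0) roots≡1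
    ...   | inj₂ roots≡2 with () ← trans (sym roots≡1) roots≡2

    binaryZeros : Carrier → Carrier → Carrier → ℕ
    binaryZeros α β γ = ∑ᵛ 1 (λ { (y , z) → nonzeroᵛ 1 (y , z) *ℕ toℕ (isZero (binary α β γ y z)) })

    nonzero-pair : ∀ {y z} → y ≢ 0# ⊎ z ≢ 0# → nonzeroᵛ 1 (y , z) ≡ 1
    nonzero-pair {y} {z} y≢0⊎z≢0 with y ≟ 0# | z ≟ 0# | y≢0⊎z≢0
    ... | no _     | _        | _         = refl
    ... | yes _    | no _     | _         = refl
    ... | yes y≡0  | yes _    | inj₁ y≢0  = ⊥-elim (y≢0 y≡0)
    ... | yes _    | yes z≡0  | inj₂ z≢0  = ⊥-elim (z≢0 z≡0)

    completing-square : ∀ α β γ y z → (2# * 2# * α) * binary α β γ y z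
      ≡ (2# * α * y + β * z) * (2# * α * y + β * z) - discriminant α β γ * (z * z)
    completing-square = solve 5 (λ α β γ y z →
      (κ 2 :* κ 2 :* α) :* P.binary α β γ y z
        := (κ 2 :* α :* y :+ β :* z) :* (κ 2 :* α :* y :+ β :* z) :- P.discriminant α β γ :* (z :* z)) refl
      where module P = QuadraticFormAlgebra (polynomials 5)

    isZero-binary : ∀ {α} β γ y z → α ≢ 0# → isZero (binary α β γ y z)
      ≡ does (((2# * α * y + β * z) * (2# * α * y + β * z)) ≟ (discriminant α β γ * (z * z)))
    isZero-binary {α} β γ y z α≢0 = does-cong (_ ≟ 0#) (_ ≟ _)
      (λ q≡0 → x-y≡0⇒x≡y _ _ (trans (sym (completing-square α β γ y z)) (trans (cong ((2# * 2# * α) *_) q≡0) (zeroʳ _))))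
      (λ eq → *-cancelˡ (*-≢0 (*-≢0 2≢0 2≢0) α≢0) (begin
        (2# * 2# * α) * binary α β γ y z         ≡⟨ completing-square α β γ y z ⟩
        _ - Δ * (z * z)                          ≡⟨ cong (_- Δ * (z * z)) eq ⟩
        Δ * (z * z) - Δ * (z * z)                ≡⟨ -‿inverseʳ _ ⟩
        0#                                       ≡⟨ zeroʳ _ ⟨
        (2# * 2# * α) * 0#                       ∎))
      where
      open ≡-Reasoning
      Δ = discriminant α β γ

    ∑-binary-zeros : ∀ {α} β γ {z} → α ≢ 0# → z ≢ 0# →
      ∑ᶠ[ y ] toℕ (isZero (binary α β γ y z)) ≡ squareRoots (discriminant α β γ)
    ∑-binary-zeros {α} β γ {z} α≢0 z≢0 = begin
      ∑ᶠ[ y ] toℕ (isZero (binary α β γ y z))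
        ≡⟨ ∑-cong elements (λ y → cong toℕ (isZero-binary β γ y z α≢0)) ⟩
      ∑ᶠ[ y ] δ ((2# * α * y + β * z) * (2# * α * y + β * z)) (Δ * (z * z))
        ≡⟨ ∑ᶠ-* (*-≢0 2≢0 α≢0) (λ u → δ ((u + β * z) * (u + β * z)) (Δ * (z * z))) ⟩
      ∑ᶠ[ u ] δ ((u + β * z) * (u + β * z)) (Δ * (z * z))
        ≡⟨ ∑ᶠ-+ (β * z) (λ u → δ (u * u) (Δ * (z * z))) ⟩
      squareRoots (Δ * (z * z))
        ≡⟨ cong squareRoots (*-comm Δ (z * z)) ⟩
      squareRoots (z * z * Δ)
        ≡⟨ squareRoots-* Δ z≢0 ⟩
      squareRoots Δ ∎
      where
      open ≡-Reasoning
      Δ = discriminant α β γ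

    binaryZeros-α≢0 : ∀ {α} β γ → α ≢ 0# → binaryZeros α β γ ≡ (order ∸ 1) *ℕ squareRoots (discriminant α β γ)
    binaryZeros-α≢0 {α} β γ α≢0 = begin
      binaryZeros α β γ
        ≡⟨ ∑-comm elements elements _ ⟩
      ∑ᶠ[ z ] ∑ᶠ[ y ] zero? y z
        ≡⟨ ∑ᶠ-split-0# _ ⟩
      ∑ᶠ[ y ] zero? y 0# +ℕ ∑ᶠ[ z ] (nonzero z *ℕ ∑ᶠ[ y ] zero? y z)
        ≡⟨ cong₂ _+ℕ_ (trans (∑-cong elements z≡0) (∑-zero elements)) (∑ᶠ-nonzero-const _ _ z≢0) ⟩
      (order ∸ 1) *ℕ squareRoots (discriminant α β γ) ∎
      where
      open ≡-Reasoning
      zero? : Carrier → Carrier → ℕ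
      zero? y z = nonzeroᵛ 1 (y , z) *ℕ toℕ (isZero (binary α β γ y z))
      z≡0 : ∀ y → zero? y 0# ≡ 0
      z≡0 y with y ≟ 0#
      ... | yes refl = cong (λ b → toℕ (not (true ∧ b)) *ℕ toℕ (isZero (binary α β γ 0# 0#))) isZero-0#
      ... | no y≢0   = cong (λ b → 1 *ℕ toℕ b) (isZero-≢0 (λ q≡0 → *-≢0 (*-≢0 α≢0 y≢0) y≢0 (begin
        α * y * y           ≡⟨ solve 4 (λ α β γ y → α :* y :* y := α :* y :* y :+ β :* y :* κ 0 :+ γ :* κ 0 :* κ 0) refl α β γ y ⟩
        binary α β γ y 0#   ≡⟨ q≡0 ⟩
        0#                  ∎)))
      z≢0 : ∀ z → z ≢ 0# → ∑ᶠ[ y ] zero? y z ≡ squareRoots (discriminant α β γ)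
      z≢0 z z≢0 = trans (∑-cong elements (λ y → trans (cong (_*ℕ toℕ (isZero (binary α β γ y z))) (nonzero-pair (inj₂ z≢0)))
                                                    (ℕ.+-identityʳ _)))
                        (∑-binary-zeros β γ α≢0 z≢0)

    binaryZeros-swap : ∀ α β γ → binaryZeros α β γ ≡ binaryZeros γ β α
    binaryZeros-swap α β γ = trans (∑-comm elements elements _) (∑-cong elements (λ z → ∑-cong elements (λ y →
      cong₂ _*ℕ_ (cong (λ b → toℕ (not b)) (Bool.∧-comm (isZero y) (isZero z)))
                 (cong (λ x → toℕ (isZero x)) (solve 5 (λ α β γ y z →
                   α :* y :* y :+ β :* y :* z :+ γ :* z :* z := γ :* z :* z :+ β :* z :* y :+ α :* y :* y) refl α β γ y z)))))

    binaryZeros-β : ∀ {β} → β ≢ 0# → binaryZeros 0# β 0# ≡ (order ∸ 1) *ℕ 2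
    binaryZeros-β {β} β≢0 = begin
      binaryZeros 0# β 0#
        ≡⟨ ∑ᶠ-split-0# _ ⟩
      ∑ᶠ[ z ] zero? 0# z +ℕ ∑ᶠ[ y ] (nonzero y *ℕ ∑ᶠ[ z ] zero? y z)
        ≡⟨ cong₂ _+ℕ_ (trans (∑-cong elements y≡0) (trans (∑-cong elements (λ z → ℕ.*-identityʳ (nonzero z))) ∑ᶠ-nonzero))
                      (∑ᶠ-nonzero-const _ _ y≢0) ⟩
      (order ∸ 1) +ℕ (order ∸ 1) *ℕ 1
        ≡⟨ cong ((order ∸ 1) +ℕ_) (ℕ.*-identityʳ (order ∸ 1)) ⟩
      (order ∸ 1) +ℕ (order ∸ 1)
        ≡⟨ cong ((order ∸ 1) +ℕ_) (ℕ.+-identityʳ (order ∸ 1)) ⟨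
      2 *ℕ (order ∸ 1)
        ≡⟨ ℕ.*-comm 2 (order ∸ 1) ⟩
      (order ∸ 1) *ℕ 2 ∎
      where
      open ≡-Reasoning
      zero? : Carrier → Carrier → ℕ
      zero? y z = nonzeroᵛ 1 (y , z) *ℕ toℕ (isZero (binary 0# β 0# y z))
      y≡0 : ∀ z → zero? 0# z ≡ nonzero z *ℕ 1
      y≡0 z rewrite isZero-0#
        | solve 2 (λ β z → κ 0 :* κ 0 :* κ 0 :+ β :* κ 0 :* z :+ κ 0 :* z :* z := κ 0) refl β z
        | isZero-0# = refl
      βyz≡0⇔z≡0 : ∀ {y} → y ≢ 0# → ∀ z → (binary 0# β 0# y z ≡ 0#) → z ≡ 0#
      βyz≡0⇔z≡0 {y} y≢0 z q≡0 with zero-product (β * y) z (trans (solve 3 (λ β y z →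
                                    β :* y :* z := κ 0 :* y :* y :+ β :* y :* z :+ κ 0 :* z :* z) refl β y z) q≡0)
      ... | inj₁ βy≡0 = ⊥-elim (*-≢0 β≢0 y≢0 βy≡0)
      ... | inj₂ z≡0  = z≡0
      y≢0 : ∀ y → y ≢ 0# → ∑ᶠ[ z ] zero? y z ≡ 1
      y≢0 y y≢0 = trans (∑-cong elements (λ z → trans (cong (_*ℕ toℕ (isZero (binary 0# β 0# y z))) (nonzero-pair (inj₁ y≢0)))
                    (trans (ℕ.+-identityʳ _) (cong toℕ (does-cong (_ ≟ _) (z ≟ 0#) (βyz≡0⇔z≡0 y≢0 z)
                      (λ z≡0 → trans (cong (binary 0# β 0# y) z≡0)
                        (solve 2 (λ β y → κ 0 :* y :* y :+ β :* y :* κ 0 :+ κ 0 :* κ 0 :* κ 0 := κ 0) refl β y)))))))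
                  (∑ᶠ-δ 0#)

    binaryZeros-nonzero : ∀ {α β γ} → ¬ (α ≡ 0# × β ≡ 0# × γ ≡ 0#) →
      binaryZeros α β γ ≡ (order ∸ 1) *ℕ squareRoots (discriminant α β γ)
    binaryZeros-nonzero {α} {β} {γ} nonzero-form with α ≟ 0# | γ ≟ 0#
    ... | no α≢0    | _       = binaryZeros-α≢0 β γ α≢0
    ... | yes refl  | no γ≢0  = trans (binaryZeros-swap 0# β γ) (trans (binaryZeros-α≢0 β 0# γ≢0)
      (cong (λ Δ → (order ∸ 1) *ℕ squareRoots Δ)
            (solve 2 (λ β γ → β :* β :- κ 2 :* κ 2 :* γ :* κ 0 := β :* β :- κ 2 :* κ 2 :* κ 0 :* γ) refl β γ)))
    ... | yes refl  | yes refl with β ≟ 0#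
    ...   | yes β≡0 = ⊥-elim (nonzero-form (refl , β≡0 , refl))
    ...   | no β≢0  = trans (binaryZeros-β β≢0) (cong ((order ∸ 1) *ℕ_) (sym (trans
      (cong squareRoots (solve 1 (λ β → β :* β :- κ 2 :* κ 2 :* κ 0 :* κ 0 := β :* β) refl β))
      (squareRoots-square β≢0))))

module PlaneConics (K : FiniteField) (2≢0 : FiniteField.2# K ≢ FiniteField.0# K) where
  open FiniteField K hiding (2#; _-_)
  open FieldArithmetic K
  open FieldSums K
  open ProjectiveCounting K
  open SquareRoots K
  open OddCharacteristic 2≢0
  open QuadraticFormAlgebra (CommutativeRing.rawRing commutativeRing)

  NonZero : Point → Set
  NonZero (u , v , w) = ¬ (u ≡ 0# × v ≡ 0# × w ≡ 0#)

  zero-or-NonZero : ∀ P → nonzeroᵛ 2 P ≡ 0 ⊎ (NonZero P × nonzeroᵛ 2 P ≡ 1)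
  zero-or-NonZero (x , y , z) with x ≟ 0# | y ≟ 0# | z ≟ 0#
  ... | yes refl | yes refl | yes refl = inj₁ refl
  ... | no x≢0   | _        | _        = inj₂ ((λ (x≡0 , _) → x≢0 x≡0) , refl)
  ... | yes _    | no y≢0   | _        = inj₂ ((λ (_ , y≡0 , _) → y≢0 y≡0) , refl)
  ... | yes _    | yes _    | no z≢0   = inj₂ ((λ (_ , _ , z≡0) → z≢0 z≡0) , refl)

  dot-comm : ∀ ℓ P → dot ℓ P ≡ dot P ℓ
  dot-comm (u , v , w) (x , y , z) =
    solve 6 (λ u v w x y z → P.dot (u , v , w) (x , y , z) := P.dot (x , y , z) (u , v , w)) refl u v w x y z
    where module P = QuadraticFormAlgebra (polynomials 6)

  dot-scaleˡ : ∀ l ℓ P → dot (scale 2 l ℓ) P ≡ l * dot ℓ P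
  dot-scaleˡ l (u , v , w) (x , y , z) = solve 7 (λ l u v w x y z →
    P.dot (l :* u , l :* v , l :* w) (x , y , z) := l :* P.dot (u , v , w) (x , y , z)) refl l u v w x y z
    where module P = QuadraticFormAlgebra (polynomials 7)

  dot-scaleʳ : ∀ l ℓ P → dot ℓ (scale 2 l P) ≡ l * dot ℓ P
  dot-scaleʳ l ℓ P = trans (dot-comm ℓ (scale 2 l P)) (trans (dot-scaleˡ l P ℓ) (cong (l *_) (dot-comm P ℓ)))

  dot-swap₁₂ : ∀ ℓ v → dot (swap₁₂ ℓ) (swap₁₂ v) ≡ dot ℓ v
  dot-swap₁₂ (u , v , w) (x , y , z) = solve 6 (λ u v w x y z →
    P.dot (P.swap₁₂ (u , v , w)) (P.swap₁₂ (x , y , z)) := P.dot (u , v , w) (x , y , z)) refl u v w x y z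
    where module P = QuadraticFormAlgebra (polynomials 6)

  dot-swap₁₃ : ∀ ℓ v → dot (swap₁₃ ℓ) (swap₁₃ v) ≡ dot ℓ v
  dot-swap₁₃ (u , v , w) (x , y , z) = solve 6 (λ u v w x y z →
    P.dot (P.swap₁₃ (u , v , w)) (P.swap₁₃ (x , y , z)) := P.dot (u , v , w) (x , y , z)) refl u v w x y z
    where module P = QuadraticFormAlgebra (polynomials 6)

  quadratic-scale : ∀ cf l v → quadratic cf (scale 2 l v) ≡ l * l * quadratic cf v
  quadratic-scale (ternary a f e b c d) l (x , y , z) = solve 10 (λ a f e b c d l x y z →
    P.quadratic (ternary a f e b c d) (l :* x , l :* y , l :* z) := l :* l :* P.quadratic (ternary a f e b c d) (x , y , z))
    refl a f e b c d l x y z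
    where module P = QuadraticFormAlgebra (polynomials 10)

  quadratic-restrict : ∀ cf ℓ y z → let (α , β , γ) = restrictedCoefficients (quadratic cf) ℓ in
    quadratic cf (restrict ℓ y z) ≡ binary α β γ y z
  quadratic-restrict (ternary a f e b c d) (u , v , w) y z = solve 11 (λ a f e b c d u v w y z →
    let cf = ternary a f e b c d
        (α , β , γ) = P.restrictedCoefficients (P.quadratic cf) (u , v , w)
    in P.quadratic cf (P.restrict (u , v , w) y z) := P.binary α β γ y z) refl a f e b c d u v w y z
    where module P = QuadraticFormAlgebra (polynomials 11)

  discriminant-restrict : ∀ cf u v w → let (α , β , γ) = restrictedCoefficients (quadratic cf) (u , v , w) in
    discriminant α β γ ≡ u * u * - quadratic (dual cf) (u , v , w)
  discriminant-restrict (ternary a f e b c d) u v w = solve 9 (λ a f e b c d u v w →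
    let cf = ternary a f e b c d
        (α , β , γ) = P.restrictedCoefficients (P.quadratic cf) (u , v , w)
    in P.discriminant α β γ := u :* u :* :- P.quadratic (P.dual cf) (u , v , w)) refl a f e b c d u v w
    where module P = QuadraticFormAlgebra (polynomials 9)

  dual-dual : ∀ cf v → quadratic (dual (dual cf)) v ≡ 2# * 2# * 2# * determinant cf * quadratic cf v
  dual-dual (ternary a f e b c d) (x , y , z) = solve 9 (λ a f e b c d x y z →
    let cf = ternary a f e b c d
    in P.quadratic (P.dual (P.dual cf)) (x , y , z) := P.2# :* P.2# :* P.2# :* P.determinant cf :* P.quadratic cf (x , y , z))
    refl a f e b c d x y z
    where module P = QuadraticFormAlgebra (polynomials 9)

  quadratic-swap₁₂ : ∀ cf v → quadratic cf (swap₁₂ v) ≡ quadratic (swap₁₂ᶜ cf) v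
  quadratic-swap₁₂ (ternary a f e b c d) (x , y , z) = solve 9 (λ a f e b c d x y z →
    P.quadratic (ternary a f e b c d) (P.swap₁₂ (x , y , z)) := P.quadratic (P.swap₁₂ᶜ (ternary a f e b c d)) (x , y , z))
    refl a f e b c d x y z
    where module P = QuadraticFormAlgebra (polynomials 9)

  quadratic-swap₁₃ : ∀ cf v → quadratic cf (swap₁₃ v) ≡ quadratic (swap₁₃ᶜ cf) v
  quadratic-swap₁₃ (ternary a f e b c d) (x , y , z) = solve 9 (λ a f e b c d x y z →
    P.quadratic (ternary a f e b c d) (P.swap₁₃ (x , y , z)) := P.quadratic (P.swap₁₃ᶜ (ternary a f e b c d)) (x , y , z))
    refl a f e b c d x y z
    where module P = QuadraticFormAlgebra (polynomials 9)

  dual-swap₁₂ : ∀ cf v → quadratic (dual cf) (swap₁₂ v) ≡ quadratic (dual (swap₁₂ᶜ cf)) v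
  dual-swap₁₂ (ternary a f e b c d) (x , y , z) = solve 9 (λ a f e b c d x y z →
    P.quadratic (P.dual (ternary a f e b c d)) (P.swap₁₂ (x , y , z)) := P.quadratic (P.dual (P.swap₁₂ᶜ (ternary a f e b c d))) (x , y , z))
    refl a f e b c d x y z
    where module P = QuadraticFormAlgebra (polynomials 9)

  dual-swap₁₃ : ∀ cf v → quadratic (dual cf) (swap₁₃ v) ≡ quadratic (dual (swap₁₃ᶜ cf)) v
  dual-swap₁₃ (ternary a f e b c d) (x , y , z) = solve 9 (λ a f e b c d x y z →
    P.quadratic (P.dual (ternary a f e b c d)) (P.swap₁₃ (x , y , z)) := P.quadratic (P.dual (P.swap₁₃ᶜ (ternary a f e b c d))) (x , y , z))
    refl a f e b c d x y z
    where module P = QuadraticFormAlgebra (polynomials 9)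

  planeZeros : Point → (Point → Carrier) → ℕ
  planeZeros ℓ G = ∑ᵛ 2 (λ x → nonzeroᵛ 2 x *ℕ toℕ (isZero (dot ℓ x) ∧ isZero (G x)))

  planeZeros-cong : ∀ ℓ {G H : Point → Carrier} → (∀ x → G x ≡ H x) → planeZeros ℓ G ≡ planeZeros ℓ H
  planeZeros-cong ℓ G≗H = ∑ᵛ-cong 2 (λ x → cong (λ g → nonzeroᵛ 2 x *ℕ toℕ (isZero (dot ℓ x) ∧ isZero g)) (G≗H x))

  planeZeros-swap₁₂ : ∀ ℓ G → planeZeros ℓ G ≡ planeZeros (swap₁₂ ℓ) (λ x → G (swap₁₂ x))
  planeZeros-swap₁₂ (u , v , w) G = trans (∑-comm elements elements _) (∑-cong elements (λ y → ∑-cong elements (λ x →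
    ∑-cong elements (λ z → cong₂ (λ b d → toℕ (not b) *ℕ toℕ (isZero d ∧ isZero (G (x , y , z))))
      (∧-swap₁₂ (isZero x) (isZero y) (isZero z))
      (sym (dot-swap₁₂ (u , v , w) (x , y , z)))))))

  planeZeros-swap₁₃ : ∀ ℓ G → planeZeros ℓ G ≡ planeZeros (swap₁₃ ℓ) (λ x → G (swap₁₃ x))
  planeZeros-swap₁₃ (u , v , w) G =
    trans (∑-cong elements (λ x → ∑-comm elements elements _))
    (trans (∑-comm elements elements _)
    (trans (∑-cong elements (λ z → ∑-comm elements elements _))
    (∑-cong elements (λ z → ∑-cong elements (λ y → ∑-cong elements (λ x →
      cong₂ (λ b d → toℕ (not b) *ℕ toℕ (isZero d ∧ isZero (G (x , y , z))))
        (∧-swap₁₃ (isZero x) (isZero y) (isZero z))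
        (sym (dot-swap₁₃ (u , v , w) (x , y , z)))))))))

  nonzero-restrict : ∀ {u} v w → u ≢ 0# → ∀ y z → nonzeroᵛ 2 (restrict (u , v , w) y z) ≡ nonzeroᵛ 1 (y , z)
  nonzero-restrict {u} v w u≢0 y z = cong (λ b → toℕ (not b)) (begin
    isZero x₀ ∧ isZero (u * y) ∧ isZero (u * z)  ≡⟨ cong₂ (λ b c → isZero x₀ ∧ b ∧ c) (isZero-* y u≢0) (isZero-* z u≢0) ⟩
    isZero x₀ ∧ isZero y ∧ isZero z              ≡⟨ ∧-absorbˡ (isZero x₀) _ y,z≡0⇒x₀≡0 ⟩
    isZero y ∧ isZero z                          ∎)
    where
    open ≡-Reasoning
    x₀ = - (v * y + w * z)
    y,z≡0⇒x₀≡0 : isZero y ∧ isZero z ≡ true → isZero x₀ ≡ true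
    y,z≡0⇒x₀≡0 yz≡0 with y ≟ 0# | z ≟ 0#
    ... | yes refl | yes refl = trans (cong isZero (solve 2 (λ v w → :- (v :* κ 0 :+ w :* κ 0) := κ 0) refl v w)) isZero-0#

  planeZeros-restrict : ∀ {u} v w (G : Point → Carrier) → u ≢ 0# →
    planeZeros (u , v , w) G ≡ ∑ᵛ 1 (λ { (y , z) → nonzeroᵛ 1 (y , z) *ℕ toℕ (isZero (G (restrict (u , v , w) y z))) })
  planeZeros-restrict {u} v w G u≢0 = begin
    planeZeros ℓ G                                    ≡⟨ ∑-comm elements elements _ ⟩
    ∑ᶠ[ y ] ∑ᶠ[ x ] ∑ᶠ[ z ] h x y z                   ≡⟨ ∑-cong elements (λ y → ∑-comm elements elements _) ⟩
    ∑ᶠ[ y ] ∑ᶠ[ z ] ∑ᶠ[ x ] h x y z                   ≡⟨ ∑ᶠ-* u≢0 (λ y → ∑ᶠ[ z ] ∑ᶠ[ x ] h x y z) ⟨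
    ∑ᶠ[ y ] ∑ᶠ[ z ] ∑ᶠ[ x ] h x (u * y) z             ≡⟨ ∑-cong elements (λ y → ∑ᶠ-* u≢0 (λ z → ∑ᶠ[ x ] h x (u * y) z)) ⟨
    ∑ᶠ[ y ] ∑ᶠ[ z ] ∑ᶠ[ x ] h x (u * y) (u * z)       ≡⟨ ∑-cong elements (λ y → ∑-cong elements (λ z →
                                                           trans (∑-cong elements (on-plane y z)) (∑ᶠ-δ-* (x₀ y z) _))) ⟩
    ∑ᶠ[ y ] ∑ᶠ[ z ] (nonzeroᵛ 1 (y , z) *ℕ toℕ (isZero (G (restrict ℓ y z)))) ∎
    where
    open ≡-Reasoning
    ℓ = u , v , w
    h : Carrier → Carrier → Carrier → ℕ
    h x y z = nonzeroᵛ 2 (x , y , z) *ℕ toℕ (isZero (dot ℓ (x , y , z)) ∧ isZero (G (x , y , z)))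
    x₀ : Carrier → Carrier → Carrier
    x₀ y z = - (v * y + w * z)
    dot-restrict : ∀ x y z → dot ℓ (x , u * y , u * z) ≡ u * (x - x₀ y z)
    dot-restrict x y z = solve 6 (λ u v w x y z →
      u :* x :+ v :* (u :* y) :+ w :* (u :* z) := u :* (x :- (:- (v :* y :+ w :* z)))) refl u v w x y z
    on-plane : ∀ y z x → h x (u * y) (u * z) ≡ δ x (x₀ y z) *ℕ (nonzeroᵛ 1 (y , z) *ℕ toℕ (isZero (G (restrict ℓ y z))))
    on-plane y z x with x ≟ x₀ y z
    ... | yes refl = begin
      nonzeroᵛ 2 (restrict ℓ y z) *ℕ toℕ (isZero (dot ℓ (restrict ℓ y z)) ∧ isZero (G (restrict ℓ y z)))
        ≡⟨ cong₂ (λ n b → n *ℕ toℕ (b ∧ isZero (G (restrict ℓ y z))))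
                 (nonzero-restrict v w u≢0 y z)
                 (trans (cong isZero (trans (dot-restrict (x₀ y z) y z)
                          (trans (cong (u *_) (-‿inverseʳ (x₀ y z))) (zeroʳ u)))) isZero-0#) ⟩
      nonzeroᵛ 1 (y , z) *ℕ toℕ (isZero (G (restrict ℓ y z)))
        ≡⟨ ℕ.+-identityʳ _ ⟨
      nonzeroᵛ 1 (y , z) *ℕ toℕ (isZero (G (restrict ℓ y z))) +ℕ 0 ∎
    ... | no x≢x₀ = trans (cong (λ b → nonzeroᵛ 2 (x , u * y , u * z) *ℕ toℕ (b ∧ isZero (G (x , u * y , u * z))))
                                (trans (cong isZero (dot-restrict x y z)) (isZero-≢0 (*-≢0 u≢0 (λ x-x₀≡0 → x≢x₀ (x-y≡0⇒x≡y _ _ x-x₀≡0))))))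
                          (ℕ.*-zeroʳ (nonzeroᵛ 2 (x , u * y , u * z)))

  -- Either disjunct prevents the restriction of the form to the line ℓ from vanishing identically.
  NonvanishingOn : Ternary Carrier → Point → Set
  NonvanishingOn cf ℓ = (∃ λ P → dot ℓ P ≡ 0# × quadratic cf P ≢ 0#) ⊎ quadratic (dual cf) ℓ ≢ 0#

  restriction-nonzero : ∀ cf {u} v w → u ≢ 0# → NonvanishingOn cf (u , v , w) →
    let (α , β , γ) = restrictedCoefficients (quadratic cf) (u , v , w) in ¬ (α ≡ 0# × β ≡ 0# × γ ≡ 0#)
  restriction-nonzero cf {u} v w u≢0 (inj₁ ((p₁ , p₂ , p₃) , on-ℓ , Q≢0)) (α≡0 , β≡0 , γ≡0) =
    *-≢0 (*-≢0 u≢0 u≢0) Q≢0 (begin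
      u * u * quadratic cf (p₁ , p₂ , p₃)      ≡⟨ quadratic-scale cf u (p₁ , p₂ , p₃) ⟨
      quadratic cf (u * p₁ , u * p₂ , u * p₃)   ≡⟨ cong (λ x → quadratic cf (x , u * p₂ , u * p₃)) up₁≡x₀ ⟩
      quadratic cf (restrict ℓ p₂ p₃)           ≡⟨ quadratic-restrict cf ℓ p₂ p₃ ⟩
      binary α β γ p₂ p₃                        ≡⟨ cong₂ (λ α′ (βγ : Carrier × Carrier) → binary α′ (proj₁ βγ) (proj₂ βγ) p₂ p₃)
                                                         α≡0 (cong₂ _,_ β≡0 γ≡0) ⟩
      binary 0# 0# 0# p₂ p₃                     ≡⟨ solve 2 (λ y z → P.binary (κ 0) (κ 0) (κ 0) y z := κ 0) refl p₂ p₃ ⟩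
      0#                                        ∎)
    where
    open ≡-Reasoning
    module P = QuadraticFormAlgebra (polynomials 2)
    ℓ = u , v , w
    α = proj₁ (restrictedCoefficients (quadratic cf) ℓ)
    β = proj₁ (proj₂ (restrictedCoefficients (quadratic cf) ℓ))
    γ = proj₂ (proj₂ (restrictedCoefficients (quadratic cf) ℓ))
    up₁≡x₀ : u * p₁ ≡ - (v * p₂ + w * p₃)
    up₁≡x₀ = x-y≡0⇒x≡y _ _ (trans (solve 6 (λ u v w p₁ p₂ p₃ →
               u :* p₁ :- (:- (v :* p₂ :+ w :* p₃)) := u :* p₁ :+ v :* p₂ :+ w :* p₃) refl u v w p₁ p₂ p₃) on-ℓ)
  restriction-nonzero cf {u} v w u≢0 (inj₂ Q*≢0) (α≡0 , β≡0 , γ≡0) =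
    *-≢0 (*-≢0 u≢0 u≢0) (λ -Q*≡0 → Q*≢0 (-x≡0⇒x≡0 -Q*≡0)) (begin
      u * u * - quadratic (dual cf) (u , v , w) ≡⟨ discriminant-restrict cf u v w ⟨
      discriminant α β γ                        ≡⟨ cong₂ (λ α′ (βγ : Carrier × Carrier) → discriminant α′ (proj₁ βγ) (proj₂ βγ))
                                                         α≡0 (cong₂ _,_ β≡0 γ≡0) ⟩
      discriminant 0# 0# 0#                     ≡⟨ solve 0 (P.discriminant (κ 0) (κ 0) (κ 0) := κ 0) refl ⟩
      0#                                        ∎)
    where
    open ≡-Reasoning
    module P = QuadraticFormAlgebra (polynomials 0)
    α = proj₁ (restrictedCoefficients (quadratic cf) (u , v , w))
    β = proj₁ (proj₂ (restrictedCoefficients (quadratic cf) (u , v , w)))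
    γ = proj₂ (proj₂ (restrictedCoefficients (quadratic cf) (u , v , w)))

  line-zeros-u≢0 : ∀ cf {u} v w → u ≢ 0# → NonvanishingOn cf (u , v , w) →
    planeZeros (u , v , w) (quadratic cf) ≡ (order ∸ 1) *ℕ squareRoots (- quadratic (dual cf) (u , v , w))
  line-zeros-u≢0 cf {u} v w u≢0 nonvanishing = begin
    planeZeros ℓ (quadratic cf)
      ≡⟨ planeZeros-restrict v w (quadratic cf) u≢0 ⟩
    ∑ᵛ 1 (λ { (y , z) → nonzeroᵛ 1 (y , z) *ℕ toℕ (isZero (quadratic cf (restrict ℓ y z))) })
      ≡⟨ ∑ᵛ-cong 1 (λ { (y , z) → cong (λ q → nonzeroᵛ 1 (y , z) *ℕ toℕ (isZero q)) (quadratic-restrict cf ℓ y z) }) ⟩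
    binaryZeros α β γ
      ≡⟨ binaryZeros-nonzero (restriction-nonzero cf v w u≢0 nonvanishing) ⟩
    (order ∸ 1) *ℕ squareRoots (discriminant α β γ)
      ≡⟨ cong (λ Δ → (order ∸ 1) *ℕ squareRoots Δ) (discriminant-restrict cf u v w) ⟩
    (order ∸ 1) *ℕ squareRoots (u * u * - quadratic (dual cf) ℓ)
      ≡⟨ cong ((order ∸ 1) *ℕ_) (squareRoots-* _ u≢0) ⟩
    (order ∸ 1) *ℕ squareRoots (- quadratic (dual cf) ℓ) ∎
    where
    open ≡-Reasoning
    ℓ = u , v , w
    α = proj₁ (restrictedCoefficients (quadratic cf) ℓ)
    β = proj₁ (proj₂ (restrictedCoefficients (quadratic cf) ℓ))
    γ = proj₂ (proj₂ (restrictedCoefficients (quadratic cf) ℓ))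

  line-zeros : ∀ cf ℓ → NonZero ℓ → NonvanishingOn cf ℓ →
    planeZeros ℓ (quadratic cf) ≡ (order ∸ 1) *ℕ squareRoots (- quadratic (dual cf) ℓ)
  line-zeros cf (u , v , w) ℓ≢0 nonvanishing with u ≟ 0# | v ≟ 0# | w ≟ 0#
  ... | no u≢0   | _      | _      = line-zeros-u≢0 cf v w u≢0 nonvanishing
  ... | yes refl | no v≢0 | _      = begin
    planeZeros (0# , v , w) (quadratic cf)
      ≡⟨ trans (planeZeros-swap₁₂ _ _) (planeZeros-cong _ (quadratic-swap₁₂ cf)) ⟩
    planeZeros (v , 0# , w) (quadratic (swap₁₂ᶜ cf))
      ≡⟨ line-zeros-u≢0 (swap₁₂ᶜ cf) 0# w v≢0 (swapped nonvanishing) ⟩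
    (order ∸ 1) *ℕ squareRoots (- quadratic (dual (swap₁₂ᶜ cf)) (v , 0# , w))
      ≡⟨ cong (λ x → (order ∸ 1) *ℕ squareRoots (- x)) (dual-swap₁₂ cf (v , 0# , w)) ⟨
    (order ∸ 1) *ℕ squareRoots (- quadratic (dual cf) (0# , v , w)) ∎
    where
    open ≡-Reasoning
    swapped : NonvanishingOn cf (0# , v , w) → NonvanishingOn (swap₁₂ᶜ cf) (v , 0# , w)
    swapped (inj₁ (P , on-ℓ , Q≢0)) = inj₁ (swap₁₂ P , trans (dot-swap₁₂ (0# , v , w) P) on-ℓ ,
                                             λ Q≡0 → Q≢0 (trans (quadratic-swap₁₂ cf (swap₁₂ P)) Q≡0))
    swapped (inj₂ Q*≢0) = inj₂ (λ Q*≡0 → Q*≢0 (trans (dual-swap₁₂ cf (v , 0# , w)) Q*≡0))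
  ... | yes refl | yes refl | no w≢0 = begin
    planeZeros (0# , 0# , w) (quadratic cf)
      ≡⟨ trans (planeZeros-swap₁₃ _ _) (planeZeros-cong _ (quadratic-swap₁₃ cf)) ⟩
    planeZeros (w , 0# , 0#) (quadratic (swap₁₃ᶜ cf))
      ≡⟨ line-zeros-u≢0 (swap₁₃ᶜ cf) 0# 0# w≢0 (swapped nonvanishing) ⟩
    (order ∸ 1) *ℕ squareRoots (- quadratic (dual (swap₁₃ᶜ cf)) (w , 0# , 0#))
      ≡⟨ cong (λ x → (order ∸ 1) *ℕ squareRoots (- x)) (dual-swap₁₃ cf (w , 0# , 0#)) ⟨
    (order ∸ 1) *ℕ squareRoots (- quadratic (dual cf) (0# , 0# , w)) ∎
    where
    open ≡-Reasoning
    swapped : NonvanishingOn cf (0# , 0# , w) → NonvanishingOn (swap₁₃ᶜ cf) (w , 0# , 0#)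
    swapped (inj₁ (P , on-ℓ , Q≢0)) = inj₁ (swap₁₃ P , trans (dot-swap₁₃ (0# , 0# , w) P) on-ℓ ,
                                             λ Q≡0 → Q≢0 (trans (quadratic-swap₁₃ cf (swap₁₃ P)) Q≡0))
    swapped (inj₂ Q*≢0) = inj₂ (λ Q*≡0 → Q*≢0 (trans (dual-swap₁₃ cf (w , 0# , 0#)) Q*≡0))
  ... | yes refl | yes refl | yes refl = ⊥-elim (ℓ≢0 (refl , refl , refl))

  pencil-zeros : ∀ cf P → NonZero P → determinant cf ≢ 0# → quadratic cf P ≢ 0# →
    planeZeros P (quadratic (dual cf)) ≡ (order ∸ 1) *ℕ squareRoots (- (2# * 2# * 2# * determinant cf * quadratic cf P))
  pencil-zeros cf P P≢0 det≢0 Q≢0 = trans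
    (line-zeros (dual cf) P P≢0 (inj₂ (λ Q**≡0 → *-≢0 (*-≢0 (*-≢0 (*-≢0 2≢0 2≢0) 2≢0) det≢0) Q≢0 (trans (sym (dual-dual cf P)) Q**≡0))))
    (cong (λ x → (order ∸ 1) *ℕ squareRoots (- x)) (dual-dual cf P))

module QuadraticExtension (𝔽 : FiniteField) (ω : FiniteField.Carrier 𝔽)
                          (nonsquare : ∀ x → FiniteField._*_ 𝔽 x x ≢ ω) where
  open FiniteField 𝔽
  open FieldArithmetic 𝔽
  open Ext 𝔽 ω

  private
    _,≡_ : ∀ {x₁ x₂ y₁ y₂ : Carrier} → x₁ ≡ y₁ → x₂ ≡ y₂ → (x₁ , x₂) ≡ (y₁ , y₂)
    refl ,≡ refl = refl

  isCommutativeRing₂ : IsCommutativeRing _≡_ _+₂_ _*₂_ (-₂_) 0₂ 1₂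
  isCommutativeRing₂ = record
    { isRing = record
      { +-isAbelianGroup = record
        { isGroup = record
          { isMonoid = record
            { isSemigroup = record
              { isMagma = record { isEquivalence = isEquivalence ; ∙-cong = cong₂ _+₂_ }
              ; assoc   = λ { (x₁ , x₂) (y₁ , y₂) (z₁ , z₂) → +-assoc x₁ y₁ z₁ ,≡ +-assoc x₂ y₂ z₂ }
              }
            ; identity = (λ { (x₁ , x₂) → +-identityˡ x₁ ,≡ +-identityˡ x₂ })
                       , (λ { (x₁ , x₂) → +-identityʳ x₁ ,≡ +-identityʳ x₂ })
            }
          ; inverse = (λ { (x₁ , x₂) → -‿inverseˡ x₁ ,≡ -‿inverseˡ x₂ })
                    , (λ { (x₁ , x₂) → -‿inverseʳ x₁ ,≡ -‿inverseʳ x₂ })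
          ; ⁻¹-cong = cong (-₂_)
          }
        ; comm = λ { (x₁ , x₂) (y₁ , y₂) → +-comm x₁ y₁ ,≡ +-comm x₂ y₂ }
        }
      ; *-cong = cong₂ _*₂_
      ; *-assoc = λ { (x₁ , x₂) (y₁ , y₂) (z₁ , z₂) →
          solve 7 (λ w x₁ x₂ y₁ y₂ z₁ z₂ →
            (x₁ :* y₁ :+ w :* (x₂ :* y₂)) :* z₁ :+ w :* ((x₁ :* y₂ :+ x₂ :* y₁) :* z₂)
              := x₁ :* (y₁ :* z₁ :+ w :* (y₂ :* z₂)) :+ w :* (x₂ :* (y₁ :* z₂ :+ y₂ :* z₁))) refl ω x₁ x₂ y₁ y₂ z₁ z₂
          ,≡ solve 7 (λ w x₁ x₂ y₁ y₂ z₁ z₂ →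
            (x₁ :* y₁ :+ w :* (x₂ :* y₂)) :* z₂ :+ (x₁ :* y₂ :+ x₂ :* y₁) :* z₁
              := x₁ :* (y₁ :* z₂ :+ y₂ :* z₁) :+ x₂ :* (y₁ :* z₁ :+ w :* (y₂ :* z₂))) refl ω x₁ x₂ y₁ y₂ z₁ z₂ }
      ; *-identity = (λ { (x₁ , x₂) →
            solve 3 (λ w x₁ x₂ → κ 1 :* x₁ :+ w :* (κ 0 :* x₂) := x₁) refl ω x₁ x₂
            ,≡ solve 2 (λ x₁ x₂ → κ 1 :* x₂ :+ κ 0 :* x₁ := x₂) refl x₁ x₂ })
                   , (λ { (x₁ , x₂) →
            solve 3 (λ w x₁ x₂ → x₁ :* κ 1 :+ w :* (x₂ :* κ 0) := x₁) refl ω x₁ x₂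
            ,≡ solve 2 (λ x₁ x₂ → x₁ :* κ 0 :+ x₂ :* κ 1 := x₂) refl x₁ x₂ })
      ; distrib = (λ { (x₁ , x₂) (y₁ , y₂) (z₁ , z₂) →
            solve 7 (λ w x₁ x₂ y₁ y₂ z₁ z₂ →
              x₁ :* (y₁ :+ z₁) :+ w :* (x₂ :* (y₂ :+ z₂)) := (x₁ :* y₁ :+ w :* (x₂ :* y₂)) :+ (x₁ :* z₁ :+ w :* (x₂ :* z₂)))
              refl ω x₁ x₂ y₁ y₂ z₁ z₂
            ,≡ solve 6 (λ x₁ x₂ y₁ y₂ z₁ z₂ →
              x₁ :* (y₂ :+ z₂) :+ x₂ :* (y₁ :+ z₁) := (x₁ :* y₂ :+ x₂ :* y₁) :+ (x₁ :* z₂ :+ x₂ :* z₁)) refl x₁ x₂ y₁ y₂ z₁ z₂ })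
                , (λ { (x₁ , x₂) (y₁ , y₂) (z₁ , z₂) →
            solve 7 (λ w x₁ x₂ y₁ y₂ z₁ z₂ →
              (y₁ :+ z₁) :* x₁ :+ w :* ((y₂ :+ z₂) :* x₂) := (y₁ :* x₁ :+ w :* (y₂ :* x₂)) :+ (z₁ :* x₁ :+ w :* (z₂ :* x₂)))
              refl ω x₁ x₂ y₁ y₂ z₁ z₂
            ,≡ solve 6 (λ x₁ x₂ y₁ y₂ z₁ z₂ →
              (y₁ :+ z₁) :* x₂ :+ (y₂ :+ z₂) :* x₁ := (y₁ :* x₂ :+ y₂ :* x₁) :+ (z₁ :* x₂ :+ z₂ :* x₁)) refl x₁ x₂ y₁ y₂ z₁ z₂ })
      }
    ; *-comm = λ { (x₁ , x₂) (y₁ , y₂) →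
        solve 5 (λ w x₁ x₂ y₁ y₂ → x₁ :* y₁ :+ w :* (x₂ :* y₂) := y₁ :* x₁ :+ w :* (y₂ :* x₂)) refl ω x₁ x₂ y₁ y₂
        ,≡ solve 4 (λ x₁ x₂ y₁ y₂ → x₁ :* y₂ :+ x₂ :* y₁ := y₁ :* x₂ :+ y₂ :* x₁) refl x₁ x₂ y₁ y₂ }
    }

  norm : F2 → Carrier
  norm (z₁ , z₂) = z₁ * z₁ - ω * (z₂ * z₂)

  -- a vanishing norm with z₂ ≠ 0 would make ω = (z₁ / z₂)² a square
  norm-≢0 : ∀ {z} → z ≢ 0₂ → norm z ≢ 0#
  norm-≢0 {z₁ , z₂} z≢0 N≡0 with z₂ ≟ 0#
  ... | yes refl with zero-product z₁ z₁ (trans (solve 2 (λ w z₁ → z₁ :* z₁ := z₁ :* z₁ :- w :* (κ 0 :* κ 0)) refl ω z₁) N≡0)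
  ...   | inj₁ z₁≡0 = z≢0 (z₁≡0 ,≡ refl)
  ...   | inj₂ z₁≡0 = z≢0 (z₁≡0 ,≡ refl)
  norm-≢0 {z₁ , z₂} z≢0 N≡0 | no z₂≢0 = nonsquare (z₁ * i) (begin
    (z₁ * i) * (z₁ * i)                         ≡⟨ solve 4 (λ z₁ i w z₂ → (z₁ :* i) :* (z₁ :* i)
                                                     := (z₁ :* z₁ :- w :* (z₂ :* z₂)) :* (i :* i) :+ w :* ((z₂ :* i) :* (z₂ :* i)))
                                                     refl z₁ i ω z₂ ⟩
    norm (z₁ , z₂) * (i * i) + ω * ((z₂ * i) * (z₂ * i)) ≡⟨ cong₂ (λ n j → n * (i * i) + ω * (j * j)) N≡0 (x*x⁻¹≡1 z₂≢0) ⟩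
    0# * (i * i) + ω * (1# * 1#)                ≡⟨ solve 2 (λ j w → κ 0 :* j :+ w :* (κ 1 :* κ 1) := w) refl (i * i) ω ⟩
    ω                                           ∎)
    where
    open ≡-Reasoning
    i = x⁻¹ z₂≢0

  inverse₂ : ∀ z → z ≢ 0₂ → ∃ λ y → z *₂ y ≡ 1₂
  inverse₂ (z₁ , z₂) z≢0 = (z₁ * n⁻¹ , - z₂ * n⁻¹) ,
    trans (solve 4 (λ z₁ z₂ w n → z₁ :* (z₁ :* n) :+ w :* (z₂ :* (:- z₂ :* n)) := (z₁ :* z₁ :- w :* (z₂ :* z₂)) :* n)
                   refl z₁ z₂ ω n⁻¹) (x*x⁻¹≡1 N≢0)
    ,≡ solve 3 (λ z₁ z₂ n → z₁ :* (:- z₂ :* n) :+ z₂ :* (z₁ :* n) := κ 0) refl z₁ z₂ n⁻¹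
    where
    N≢0 = norm-≢0 z≢0
    n⁻¹ = x⁻¹ N≢0

  𝔽² : FiniteField
  𝔽² = record
    { Carrier           = F2
    ; _≟_               = _≟₂_
    ; _+_               = _+₂_
    ; _*_               = _*₂_
    ; -_                = -₂_
    ; 0#                = 0₂
    ; 1#                = 1₂
    ; isCommutativeRing = isCommutativeRing₂
    ; 0≢1               = λ 0₂≡1₂ → 0≢1 (cong proj₁ 0₂≡1₂)
    ; inverse           = inverse₂
    ; elements          = elements₂
    ; complete          = λ { (x , y) → ∈-cartesianProduct⁺ (complete x) (complete y) }
    ; unique            = cartesianProduct⁺ unique unique
    }

  does-≟₂ : ∀ p q → does (p ≟₂ q) ≡ does (proj₁ p ≟ proj₁ q) ∧ does (proj₂ p ≟ proj₂ q)
  does-≟₂ (p₁ , p₂) (q₁ , q₂) with p₁ ≟ q₁ | p₂ ≟ q₂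
  ... | yes refl | yes refl = refl
  ... | yes refl | no _     = refl
  ... | no _     | _        = refl

module ConicTangents (𝔽 : FiniteField) (ω : FiniteField.Carrier 𝔽) (nonsquare : ∀ x → FiniteField._*_ 𝔽 x x ≢ ω)
                     (2≢0 : FiniteField.2# 𝔽 ≢ FiniteField.0# 𝔽) (a b c d e : Ext.F2 𝔽 ω) where
  open Ext 𝔽 ω
  open Conic a b c d e
  open QuadraticExtension 𝔽 ω nonsquare
  open FiniteField 𝔽² using (order; _≟_; _+_; _*_; -_)
  open FieldArithmetic 𝔽²
  open FieldSums 𝔽²
  open ProjectiveCounting 𝔽²
  open SquareRoots 𝔽²
  open QuadraticFormAlgebra (CommutativeRing.rawRing commutativeRing)

  2₂≢0₂ : 2# ≢ 0₂
  2₂≢0₂ 2₂≡0₂ = 2≢0 (cong proj₁ 2₂≡0₂)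

  open OddCharacteristic 2₂≢0₂
  open PlaneConics 𝔽² 2₂≢0₂

  coefficients : Ternary F2
  coefficients = ternary a 0₂ e b c d

  form≡quadratic : ∀ P → form P ≡ quadratic coefficients P
  form≡quadratic (x , y , z) = solve 8 (λ a b c d e x y z →
    a :* x :* x :+ b :* x :* y :+ c :* x :* z :+ d :* y :* z :+ e :* z :* z
      := P.quadratic (ternary a (κ 0) e b c d) (x , y , z)) refl a b c d e x y z
    where module P = QuadraticFormAlgebra (polynomials 8)

  onC-scale : ∀ {l} P → l ≢ 0₂ → onC (scale 2 l P) ≡ onC P
  onC-scale {l} P l≢0 = begin
    isZero (form (scale 2 l P))                    ≡⟨ cong isZero (form≡quadratic (scale 2 l P)) ⟩
    isZero (quadratic coefficients (scale 2 l P))  ≡⟨ cong isZero (quadratic-scale coefficients l P) ⟩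
    isZero (l * l * quadratic coefficients P)      ≡⟨ isZero-* _ (*-≢0 l≢0 l≢0) ⟩
    isZero (quadratic coefficients P)              ≡⟨ cong isZero (form≡quadratic P) ⟨
    isZero (form P)                                ∎
    where open ≡-Reasoning

  incident-scaleˡ : ∀ {l} ℓ P → l ≢ 0₂ → incident (scale 2 l ℓ) P ≡ incident ℓ P
  incident-scaleˡ ℓ P l≢0 = trans (cong isZero (dot-scaleˡ _ ℓ P)) (isZero-* _ l≢0)

  incident-scaleʳ : ∀ {l} ℓ P → l ≢ 0₂ → incident ℓ (scale 2 l P) ≡ incident ℓ P
  incident-scaleʳ ℓ P l≢0 = trans (cong isZero (dot-scaleʳ _ ℓ P)) (isZero-* _ l≢0)

  pointsOn : F2 × F2 × F2 → ℕ
  pointsOn ℓ = count (λ P → incident ℓ P ∧ onC P) points₂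

  tangent-scale : ∀ {l} ℓ → l ≢ 0₂ → tangent (scale 2 l ℓ) ≡ tangent ℓ
  tangent-scale ℓ l≢0 = cong (λ n → does (n ℕ.≟ 1)) (trans (count≡∑ _ points₂)
    (trans (∑-cong points₂ (λ P → cong (λ i → toℕ (i ∧ onC P)) (incident-scaleˡ ℓ P l≢0))) (sym (count≡∑ _ points₂))))

  pointsOn≡squareRoots : ∀ ℓ → NonZero ℓ → NonvanishingOn coefficients ℓ →
    pointsOn ℓ ≡ squareRoots (- quadratic (dual coefficients) ℓ)
  pointsOn≡squareRoots ℓ ℓ≢0 nonvanishing = *-cancel-order∸1 (begin
    (order ∸ 1) *ℕ pointsOn ℓ
      ≡⟨ cong (λ ps → (order ∸ 1) *ℕ count (λ P → incident ℓ P ∧ onC P) ps) PG2≡projectivePoints ⟩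
    (order ∸ 1) *ℕ count (λ P → incident ℓ P ∧ onC P) (projectivePoints 2)
      ≡⟨ count-projectivePoints 2 _ (λ P l≢0 → cong toℕ (cong₂ _∧_ (incident-scaleʳ ℓ P l≢0) (onC-scale P l≢0))) ⟩
    ∑ᵛ 2 (λ P → nonzeroᵛ 2 P *ℕ toℕ (incident ℓ P ∧ onC P))
      ≡⟨ ∑ᵛ-cong 2 (λ P → cong (λ q → nonzeroᵛ 2 P *ℕ toℕ (incident ℓ P ∧ isZero q)) (form≡quadratic P)) ⟩
    planeZeros ℓ (quadratic coefficients)
      ≡⟨ line-zeros coefficients ℓ ℓ≢0 nonvanishing ⟩
    (order ∸ 1) *ℕ squareRoots (- quadratic (dual coefficients) ℓ) ∎)
    where open ≡-Reasoning

  tangent≡isZero-dual : ∀ ℓ → NonZero ℓ → NonvanishingOn coefficients ℓ → tangent ℓ ≡ isZero (quadratic (dual coefficients) ℓ)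
  tangent≡isZero-dual ℓ ℓ≢0 nonvanishing = does-cong (pointsOn ℓ ℕ.≟ 1) (Q* ≟ 0₂)
    (λ points≡1 → -x≡0⇒x≡0 (squareRoots≡1⇒≡0 (trans (sym (pointsOn≡squareRoots ℓ ℓ≢0 nonvanishing)) points≡1)))
    (λ Q*≡0 → trans (pointsOn≡squareRoots ℓ ℓ≢0 nonvanishing)
                    (trans (cong (λ x → squareRoots (- x)) Q*≡0) (trans (cong squareRoots -0#≈0#) squareRoots-0#)))
    where
    Q* = quadratic (dual coefficients) ℓ

  nTangents≡squareRoots : ∀ P → NonZero P → form P ≢ 0₂ → determinant coefficients ≢ 0₂ →
    nTangents P ≡ squareRoots (- (2# * 2# * 2# * determinant coefficients * quadratic coefficients P))
  nTangents≡squareRoots P P≢0 Q≢0 det≢0 = *-cancel-order∸1 (begin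
    (order ∸ 1) *ℕ nTangents P
      ≡⟨ cong (λ ls → (order ∸ 1) *ℕ count (λ ℓ → tangent ℓ ∧ incident ℓ P) ls) PG2≡projectivePoints ⟩
    (order ∸ 1) *ℕ count (λ ℓ → tangent ℓ ∧ incident ℓ P) (projectivePoints 2)
      ≡⟨ count-projectivePoints 2 _ (λ ℓ l≢0 → cong toℕ (cong₂ _∧_ (tangent-scale ℓ l≢0) (incident-scaleˡ ℓ P l≢0))) ⟩
    ∑ᵛ 2 (λ ℓ → nonzeroᵛ 2 ℓ *ℕ toℕ (tangent ℓ ∧ incident ℓ P))
      ≡⟨ ∑ᵛ-cong 2 through-P ⟩
    planeZeros P (quadratic (dual coefficients))
      ≡⟨ pencil-zeros coefficients P P≢0 det≢0 (λ Q≡0 → Q≢0 (trans (form≡quadratic P) Q≡0)) ⟩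
    (order ∸ 1) *ℕ squareRoots (- (2# * 2# * 2# * determinant coefficients * quadratic coefficients P)) ∎)
    where
    open ≡-Reasoning
    through-P : ∀ ℓ → nonzeroᵛ 2 ℓ *ℕ toℕ (tangent ℓ ∧ incident ℓ P)
                    ≡ nonzeroᵛ 2 ℓ *ℕ toℕ (isZero (dot P ℓ) ∧ isZero (quadratic (dual coefficients) ℓ))
    through-P ℓ with zero-or-NonZero ℓ
    ... | inj₁ ℓ≡0 rewrite ℓ≡0 = refl
    ... | inj₂ (ℓ≢0 , _) = cong (λ b → nonzeroᵛ 2 ℓ *ℕ toℕ b) (trans
      (∧-guarded-swap (tangent ℓ) (incident ℓ P) (isZero (quadratic (dual coefficients) ℓ)) (λ on-ℓ → tangent≡isZero-dual ℓ ℓ≢0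
        (inj₁ (P , isZero⇒≡0 on-ℓ , λ Q≡0 → Q≢0 (trans (form≡quadratic P) Q≡0)))))
      (cong (λ x → isZero x ∧ isZero (quadratic (dual coefficients) ℓ)) (dot-comm ℓ P)))

  Δ : F2
  Δ = (-₂ (b *₂ c *₂ d)) +₂ a *₂ d *₂ d +₂ b *₂ b *₂ e

  determinant≡-2Δ : determinant coefficients ≡ - (2# * Δ)
  determinant≡-2Δ = solve 5 (λ a b c d e →
    P.determinant (ternary a (κ 0) e b c d) := :- (κ 2 :* (:- (b :* c :* d) :+ a :* d :* d :+ b :* b :* e))) refl a b c d e
    where module P = QuadraticFormAlgebra (polynomials 5)

  NonSingular⇒determinant≢0 : NonSingular → determinant coefficients ≢ 0₂
  NonSingular⇒determinant≢0 nonsingular det≡0 = nonsingular (trans (solve 5 (λ a b c d e →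
    (κ 2 :* a) :* (κ 0 :* (κ 2 :* e) :- d :* d) :- b :* (b :* (κ 2 :* e) :- d :* c) :+ c :* (b :* d :- κ 0 :* c)
      := P.determinant (ternary a (κ 0) e b c d)) refl a b c d e) det≡0)
    where module P = QuadraticFormAlgebra (polynomials 5)

  nTangents≡squareRoots-form : NonSingular → isSquare₂ Δ → ∀ P → NonZero P → form P ≢ 0₂ → nTangents P ≡ squareRoots (form P)
  nTangents≡squareRoots-form nonsingular (s , s²≡Δ) P P≢0 Q≢0 = begin
    nTangents P
      ≡⟨ nTangents≡squareRoots P P≢0 Q≢0 det≢0 ⟩
    squareRoots (- (2# * 2# * 2# * determinant coefficients * Q))
      ≡⟨ cong squareRoots (trans (cong (λ D → - (2# * 2# * 2# * D * Q)) (trans determinant≡-2Δ (cong (λ x → - (2# * x)) (sym s²≡Δ))))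
           (solve 2 (λ s Q → :- (κ 2 :* κ 2 :* κ 2 :* (:- (κ 2 :* (s :* s))) :* Q) := (κ 2 :* κ 2 :* s) :* (κ 2 :* κ 2 :* s) :* Q) refl s Q)) ⟩
    squareRoots ((2# * 2# * s) * (2# * 2# * s) * Q)
      ≡⟨ squareRoots-* Q (*-≢0 (*-≢0 2₂≢0₂ 2₂≢0₂) s≢0) ⟩
    squareRoots Q
      ≡⟨ cong squareRoots (form≡quadratic P) ⟨
    squareRoots (form P) ∎
    where
    open ≡-Reasoning
    Q = quadratic coefficients P
    det≢0 = NonSingular⇒determinant≢0 nonsingular
    s≢0 : s ≢ 0₂
    s≢0 s≡0 = det≢0 (trans determinant≡-2Δ (trans (cong (λ x → - (2# * x)) (trans (sym s²≡Δ) (cong (λ x → x * x) s≡0)))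
                      (solve 0 (:- (κ 2 :* (κ 0 :* κ 0)) := κ 0) refl)))

  private
    zero-or-two : ∀ n → n ≡ 0 ⊎ n ≡ 2 → 2 *ℕ toℕ (does (n ℕ.≟ 2)) +ℕ 0 ≡ n
    zero-or-two _ (inj₁ refl) = refl
    zero-or-two _ (inj₂ refl) = refl

  external-count : NonSingular → isSquare₂ Δ → ∀ P → NonZero P → 2 *ℕ toℕ (external P) +ℕ toℕ (onC P) ≡ squareRoots (form P)
  external-count nonsingular square P P≢0 with form P ≟ 0₂
  ... | yes Q≡0 = sym (trans (cong squareRoots Q≡0) squareRoots-0#)
  ... | no Q≢0 = trans (zero-or-two (nTangents P) (subst (λ n → n ≡ 0 ⊎ n ≡ 2) (sym tangents≡roots) (squareRoots-≢0 Q≢0)))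
                       tangents≡roots
    where
    tangents≡roots = nTangents≡squareRoots-form nonsingular square P P≢0 Q≢0

  external-scale : ∀ {l} P → l ≢ 0₂ → external (scale 2 l P) ≡ external P
  external-scale P l≢0 = cong₂ (λ o n → not o ∧ does (n ℕ.≟ 2)) (onC-scale P l≢0) nTangents-scale
    where
    nTangents-scale : nTangents (scale 2 _ P) ≡ nTangents P
    nTangents-scale = trans (count≡∑ _ lines₂) (trans (∑-cong lines₂ (λ ℓ → cong (λ i → toℕ (tangent ℓ ∧ i))
                        (incident-scaleʳ ℓ P l≢0))) (sym (count≡∑ _ lines₂)))

module CubicSurface (𝔽 : FiniteField) (ω : FiniteField.Carrier 𝔽) (b₁ b₂ d₁ d₂ A B C D : FiniteField.Carrier 𝔽) where
  open FiniteField 𝔽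
  open FieldArithmetic 𝔽
  open FieldSums 𝔽
  open ProjectiveCounting 𝔽
  open Ext.Cubic 𝔽 ω b₁ b₂ d₁ d₂ A B C D

  mixedZeros : ℕ
  mixedZeros = ∑ᵛ 1 (λ { (X , Z) → nonzeroᵛ 1 (X , Z) *ℕ
                 ∑ᵛ 1 (λ { (t₁ , t₂) → nonzeroᵛ 1 (t₁ , t₂) *ℕ toℕ (isZero (cubic (t₁ , t₂ , X , Z))) }) })

  cubic-scale : ∀ l v → cubic (scale 3 l v) ≡ l * l * l * cubic v
  cubic-scale l (t₁ , t₂ , X , Z) = solve 14 (λ w b₁ b₂ d₁ d₂ A B C D l t₁ t₂ X Z →
    let cubic : _ → _ → _ → _ → _
        cubic t₁ t₂ X Z = κ 2 :* t₁ :* t₂ :* (b₁ :* X :+ d₁ :* Z) :- (t₁ :* t₁ :+ w :* (t₂ :* t₂)) :* (b₂ :* X :+ d₂ :* Z)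
                            :+ A :* X :* X :* X :+ B :* X :* X :* Z :+ C :* X :* Z :* Z :+ D :* Z :* Z :* Z
    in cubic (l :* t₁) (l :* t₂) (l :* X) (l :* Z) := l :* l :* l :* cubic t₁ t₂ X Z)
    refl ω b₁ b₂ d₁ d₂ A B C D l t₁ t₂ X Z

  onS-scale : ∀ {l} v → l ≢ 0# → onS (scale 3 l v) ≡ onS v
  onS-scale {l} v l≢0 = trans (cong isZero (cubic-scale l v)) (isZero-* _ (*-≢0 (*-≢0 l≢0 l≢0) l≢0))

  affine-count : (p : Vector 3 → Bool) → Homogeneous 3 (λ v → toℕ (p v)) →
    (order ∸ 1) *ℕ count p (PG3 0# 1# elements) ≡ ∑ᵛ 3 (λ v → nonzeroᵛ 3 v *ℕ toℕ (p v))
  affine-count p hom = trans (cong (λ ps → (order ∸ 1) *ℕ count p ps) PG3≡projectivePoints) (count-projectivePoints 3 p hom)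

  Sq-affine : (order ∸ 1) *ℕ Sq ≡ ∑ᵛ 3 (λ v → nonzeroᵛ 3 v *ℕ toℕ (onS v))
  Sq-affine = affine-count onS (λ v l≢0 → cong toℕ (onS-scale v l≢0))

  n₀-affine : (order ∸ 1) *ℕ n₀ ≡ ∑ᵛ 3 (λ { v@(t₁ , t₂ , _) → nonzeroᵛ 3 v *ℕ toℕ (onS v ∧ isZero t₁ ∧ isZero t₂) })
  n₀-affine = affine-count _ (λ { v@(t₁ , t₂ , _) l≢0 → cong toℕ (cong₂ _∧_ (onS-scale v l≢0)
                                                                           (cong₂ _∧_ (isZero-* t₁ l≢0) (isZero-* t₂ l≢0))) })

  n∞-affine : (order ∸ 1) *ℕ n∞ ≡ ∑ᵛ 3 (λ { v@(_ , _ , X , Z) → nonzeroᵛ 3 v *ℕ toℕ (onS v ∧ isZero X ∧ isZero Z) })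
  n∞-affine = affine-count _ (λ { v@(_ , _ , X , Z) l≢0 → cong toℕ (cong₂ _∧_ (onS-scale v l≢0)
                                                                             (cong₂ _∧_ (isZero-* X l≢0) (isZero-* Z l≢0))) })

  -- p and r say that (t₁ , t₂) and (X , Z) vanish; a nonzero vector has p, or r, or neither, never both.
  private
    split-by-blocks : ∀ p r o {z} → z ≡ p ∧ r →
      toℕ (not z) *ℕ toℕ o ≡ toℕ (not z) *ℕ toℕ (o ∧ p) +ℕ toℕ (not z) *ℕ toℕ (o ∧ r) +ℕ toℕ (not p) *ℕ toℕ (not r) *ℕ toℕ o
    split-by-blocks true  true  o     refl = refl
    split-by-blocks true  false true  refl = refl
    split-by-blocks true  false false refl = refl
    split-by-blocks false true  true  refl = refl
    split-by-blocks false true  false refl = refl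
    split-by-blocks false false true  refl = refl
    split-by-blocks false false false refl = refl

  ∑-onS-split : ∑ᵛ 3 (λ v → nonzeroᵛ 3 v *ℕ toℕ (onS v))
    ≡ ∑ᵛ 3 (λ { v@(t₁ , t₂ , _) → nonzeroᵛ 3 v *ℕ toℕ (onS v ∧ isZero t₁ ∧ isZero t₂) })
      +ℕ ∑ᵛ 3 (λ { v@(_ , _ , X , Z) → nonzeroᵛ 3 v *ℕ toℕ (onS v ∧ isZero X ∧ isZero Z) })
      +ℕ mixedZeros
  ∑-onS-split = begin
    ∑ᵛ 3 (λ v → nonzeroᵛ 3 v *ℕ toℕ (onS v))
      ≡⟨ ∑ᵛ-cong 3 (λ { v@(t₁ , t₂ , X , Z) → split-by-blocks (isZero t₁ ∧ isZero t₂) (isZero X ∧ isZero Z) (onS v)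
                                                 (sym (Bool.∧-assoc (isZero t₁) (isZero t₂) _)) }) ⟩
    ∑ᵛ 3 (λ { v@(t₁ , t₂ , X , Z) → N₀ v +ℕ N∞ v +ℕ M v })
      ≡⟨ trans (∑ᵛ-+ 3 _ M) (cong (_+ℕ ∑ᵛ 3 M) (∑ᵛ-+ 3 N₀ N∞)) ⟩
    ∑ᵛ 3 N₀ +ℕ ∑ᵛ 3 N∞ +ℕ ∑ᵛ 3 M
      ≡⟨ cong (∑ᵛ 3 N₀ +ℕ ∑ᵛ 3 N∞ +ℕ_) mixed ⟩
    ∑ᵛ 3 N₀ +ℕ ∑ᵛ 3 N∞ +ℕ mixedZeros ∎
    where
    open ≡-Reasoning
    N₀ N∞ M : Vector 3 → ℕ
    N₀ v@(t₁ , t₂ , _) = nonzeroᵛ 3 v *ℕ toℕ (onS v ∧ isZero t₁ ∧ isZero t₂)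
    N∞ v@(_ , _ , X , Z) = nonzeroᵛ 3 v *ℕ toℕ (onS v ∧ isZero X ∧ isZero Z)
    M v@(t₁ , t₂ , X , Z) = nonzeroᵛ 1 (t₁ , t₂) *ℕ nonzeroᵛ 1 (X , Z) *ℕ toℕ (onS v)
    mixed : ∑ᵛ 3 M ≡ mixedZeros
    mixed = begin
      ∑ᶠ[ t₁ ] ∑ᶠ[ t₂ ] ∑ᶠ[ X ] ∑ᶠ[ Z ] M (t₁ , t₂ , X , Z)
        ≡⟨ ∑-cong elements (λ t₁ → trans (∑-comm elements elements _) (∑-cong elements (λ X → ∑-comm elements elements _))) ⟩
      ∑ᶠ[ t₁ ] ∑ᶠ[ X ] ∑ᶠ[ Z ] ∑ᶠ[ t₂ ] M (t₁ , t₂ , X , Z)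
        ≡⟨ trans (∑-comm elements elements _) (∑-cong elements (λ X → ∑-comm elements elements _)) ⟩
      ∑ᶠ[ X ] ∑ᶠ[ Z ] ∑ᶠ[ t₁ ] ∑ᶠ[ t₂ ] M (t₁ , t₂ , X , Z)
        ≡⟨ ∑-cong elements (λ X → ∑-cong elements (λ Z → trans
             (∑-cong elements (λ t₁ → trans (∑-cong elements (λ t₂ → factor (nonzeroᵛ 1 (t₁ , t₂)) (nonzeroᵛ 1 (X , Z)) _))
                                            (∑-*ˡ elements (nonzeroᵛ 1 (X , Z)) _)))
             (∑-*ˡ elements (nonzeroᵛ 1 (X , Z)) _))) ⟩
      mixedZeros ∎
      where
      factor : ∀ m n k → m *ℕ n *ℕ k ≡ n *ℕ (m *ℕ k)
      factor m n k = trans (cong (_*ℕ k) (ℕ.*-comm m n)) (ℕ.*-assoc n m k)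

  Sq-decomposition : (order ∸ 1) *ℕ Sq ≡ (order ∸ 1) *ℕ n₀ +ℕ (order ∸ 1) *ℕ n∞ +ℕ mixedZeros
  Sq-decomposition = trans Sq-affine (trans ∑-onS-split
    (cong (_+ℕ mixedZeros) (cong₂ _+ℕ_ (sym n₀-affine) (sym n∞-affine))))

module ExternalPoints (𝔽 : FiniteField) (ω : FiniteField.Carrier 𝔽) (nonsquare : ∀ x → FiniteField._*_ 𝔽 x x ≢ ω)
                      (2≢0 : FiniteField.2# 𝔽 ≢ FiniteField.0# 𝔽) (a b c d e : Ext.F2 𝔽 ω) where
  open FiniteField 𝔽
  open Ext 𝔽 ω
  open Conic a b c d e
  open FieldArithmetic 𝔽
  open FieldSums 𝔽
  open ProjectiveCounting 𝔽
  open PlaneConics 𝔽 2≢0 using (NonZero; zero-or-NonZero)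
  open QuadraticExtension 𝔽 ω nonsquare using (𝔽²; does-≟₂)
  open ConicTangents 𝔽 ω nonsquare 2≢0 a b c d e using (Δ; 2₂≢0₂; external-count; external-scale)
  private
    module F² = FieldSums 𝔽²
    module A² = FieldArithmetic 𝔽²
    module P² = ProjectiveCounting 𝔽²
    module S² = SquareRoots 𝔽²

  embᵖ : Vector 2 → F2 × F2 × F2
  embᵖ (x , y , z) = emb x , emb y , emb z

  embᵖ-scale : ∀ l v → embᵖ (scale 2 l v) ≡ P².scale 2 (emb l) (embᵖ v)
  embᵖ-scale l (x , y , z) = cong₂ _,_ (emb-* x) (cong₂ _,_ (emb-* y) (emb-* z))
    where
    emb-* : ∀ x → emb (l * x) ≡ emb l *₂ emb x
    emb-* x = cong₂ _,_ (solve 3 (λ w l x → l :* x := l :* x :+ w :* (κ 0 :* κ 0)) refl ω l x)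
                        (solve 2 (λ l x → κ 0 := l :* κ 0 :+ κ 0 :* x) refl l x)

  embᵖ-NonZero : ∀ v → NonZero v → PlaneConics.NonZero 𝔽² 2₂≢0₂ (embᵖ v)
  embᵖ-NonZero v v≢0 (x≡0 , y≡0 , z≡0) = v≢0 (cong proj₁ x≡0 , cong proj₁ y≡0 , cong proj₁ z≡0)

  Eq-affine : (order ∸ 1) *ℕ Eq ≡ ∑ᵛ 2 (λ v → nonzeroᵛ 2 v *ℕ toℕ (external (embᵖ v)))
  Eq-affine = begin
    (order ∸ 1) *ℕ count external (map embᵖ (PG2 0# 1# elements))
      ≡⟨ cong ((order ∸ 1) *ℕ_) (trans (count-map external embᵖ (PG2 0# 1# elements)) (cong (count (λ v → external (embᵖ v))) PG2≡projectivePoints)) ⟩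
    (order ∸ 1) *ℕ count (λ v → external (embᵖ v)) (projectivePoints 2)
      ≡⟨ count-projectivePoints 2 _ (λ v l≢0 → cong toℕ (trans (cong external (embᵖ-scale _ v))
                                                             (external-scale (embᵖ v) (λ l≡0 → l≢0 (cong proj₁ l≡0))))) ⟩
    ∑ᵛ 2 (λ v → nonzeroᵛ 2 v *ℕ toℕ (external (embᵖ v))) ∎
    where open ≡-Reasoning

  nonzeroSquareRoots : F2 → ℕ
  nonzeroSquareRoots s = F².∑ᶠ (λ t → F².nonzero t *ℕ F².δ (t *₂ t) s)

  squareRoots-split : ∀ s → S².squareRoots s ≡ toℕ (eq₂ s 0₂) +ℕ nonzeroSquareRoots s
  squareRoots-split s = trans (F².∑ᶠ-split-0# (λ t → F².δ (t *₂ t) s))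
    (cong (_+ℕ nonzeroSquareRoots s) (cong toℕ (does-cong ((0₂ *₂ 0₂) ≟₂ s) (s ≟₂ 0₂)
      (λ 0≡s → trans (sym 0≡s) (A².zeroʳ 0₂)) (λ s≡0 → trans (A².zeroʳ 0₂) (sym s≡0)))))

  twice-external : NonSingular → isSquare₂ Δ → ∀ v →
    2 *ℕ (nonzeroᵛ 2 v *ℕ toℕ (external (embᵖ v))) ≡ nonzeroᵛ 2 v *ℕ nonzeroSquareRoots (form (embᵖ v))
  twice-external nonsingular square v with zero-or-NonZero v
  ... | inj₁ v≡0 rewrite v≡0 = refl
  ... | inj₂ (v≢0 , v≡1) rewrite v≡1 = ℕ.+-cancelʳ-≡ (toℕ (onC (embᵖ v))) _ _ (begin
    2 *ℕ (toℕ (external (embᵖ v)) +ℕ 0) +ℕ toℕ (onC (embᵖ v))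
      ≡⟨ cong (λ n → 2 *ℕ n +ℕ toℕ (onC (embᵖ v))) (ℕ.+-identityʳ (toℕ (external (embᵖ v)))) ⟩
    2 *ℕ toℕ (external (embᵖ v)) +ℕ toℕ (onC (embᵖ v))
      ≡⟨ external-count nonsingular square (embᵖ v) (embᵖ-NonZero v v≢0) ⟩
    S².squareRoots (form (embᵖ v))
      ≡⟨ squareRoots-split (form (embᵖ v)) ⟩
    toℕ (onC (embᵖ v)) +ℕ nonzeroSquareRoots (form (embᵖ v))
      ≡⟨ ℕ.+-comm (toℕ (onC (embᵖ v))) (nonzeroSquareRoots (form (embᵖ v))) ⟩
    nonzeroSquareRoots (form (embᵖ v)) +ℕ toℕ (onC (embᵖ v))
      ≡⟨ cong (_+ℕ toℕ (onC (embᵖ v))) (ℕ.+-identityʳ (nonzeroSquareRoots (form (embᵖ v)))) ⟨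
    (nonzeroSquareRoots (form (embᵖ v)) +ℕ 0) +ℕ toℕ (onC (embᵖ v)) ∎)
    where open ≡-Reasoning

  twice-Eq : NonSingular → isSquare₂ Δ →
    2 *ℕ ((order ∸ 1) *ℕ Eq) ≡ ∑ᵛ 2 (λ v → nonzeroᵛ 2 v *ℕ nonzeroSquareRoots (form (embᵖ v)))
  twice-Eq nonsingular square = begin
    2 *ℕ ((order ∸ 1) *ℕ Eq)                                        ≡⟨ cong (2 *ℕ_) Eq-affine ⟩
    2 *ℕ ∑ᵛ 2 (λ v → nonzeroᵛ 2 v *ℕ toℕ (external (embᵖ v)))       ≡⟨ ∑ᵛ-*ˡ 2 2 _ ⟨
    ∑ᵛ 2 (λ v → 2 *ℕ (nonzeroᵛ 2 v *ℕ toℕ (external (embᵖ v))))     ≡⟨ ∑ᵛ-cong 2 (twice-external nonsingular square) ⟩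
    ∑ᵛ 2 (λ v → nonzeroᵛ 2 v *ℕ nonzeroSquareRoots (form (embᵖ v))) ∎
    where open ≡-Reasoning

  a₁ = proj₁ a
  a₂ = proj₂ a
  b₁ = proj₁ b
  b₂ = proj₂ b
  c₁ = proj₁ c
  c₂ = proj₂ c
  d₁ = proj₁ d
  d₂ = proj₂ d
  e₁ = proj₁ e
  e₂ = proj₂ e
  A = a₁ * b₂ - a₂ * b₁
  B = b₂ * c₁ - b₁ * c₂ - a₂ * d₁ + a₁ * d₂
  C = - (c₂ * d₁) + c₁ * d₂ + b₂ * e₁ - b₁ * e₂
  D = d₂ * e₁ - d₁ * e₂
  open Cubic b₁ b₂ d₁ d₂ A B C D using (cubic)
  open CubicSurface 𝔽 ω b₁ b₂ d₁ d₂ A B C D using (mixedZeros)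

  L₁ L₂ G₁ G₂ : Carrier → Carrier → Carrier
  L₁ X Z = b₁ * X + d₁ * Z
  L₂ X Z = b₂ * X + d₂ * Z
  G₁ X Z = a₁ * X * X + c₁ * X * Z + e₁ * Z * Z
  G₂ X Z = a₂ * X * X + c₂ * X * Z + e₂ * Z * Z

  form-affine : ∀ X Y Z → form (embᵖ (X , Y , Z)) ≡ (Y * L₁ X Z + G₁ X Z , Y * L₂ X Z + G₂ X Z)
  form-affine X Y Z = cong₂ _,_
    (solve 14 (λ w a₁ a₂ b₁ b₂ c₁ c₂ d₁ d₂ e₁ e₂ X Y Z → let open QuadraticExtensionAlgebra (polynomials 14) w in
       proj₁ (conicForm (a₁ , a₂) (b₁ , b₂) (c₁ , c₂) (d₁ , d₂) (e₁ , e₂) ((X , κ 0) , (Y , κ 0) , (Z , κ 0)))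
         := Y :* (b₁ :* X :+ d₁ :* Z) :+ (a₁ :* X :* X :+ c₁ :* X :* Z :+ e₁ :* Z :* Z))
       refl ω a₁ a₂ b₁ b₂ c₁ c₂ d₁ d₂ e₁ e₂ X Y Z)
    (solve 14 (λ w a₁ a₂ b₁ b₂ c₁ c₂ d₁ d₂ e₁ e₂ X Y Z → let open QuadraticExtensionAlgebra (polynomials 14) w in
       proj₂ (conicForm (a₁ , a₂) (b₁ , b₂) (c₁ , c₂) (d₁ , d₂) (e₁ , e₂) ((X , κ 0) , (Y , κ 0) , (Z , κ 0)))
         := Y :* (b₂ :* X :+ d₂ :* Z) :+ (a₂ :* X :* X :+ c₂ :* X :* Z :+ e₂ :* Z :* Z))
       refl ω a₁ a₂ b₁ b₂ c₁ c₂ d₁ d₂ e₁ e₂ X Y Z)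

  w₁ w₂ : Carrier → Carrier → Carrier → Carrier → Carrier
  w₁ t₁ t₂ X Z = (t₁ * t₁ + ω * (t₂ * t₂)) - G₁ X Z
  w₂ t₁ t₂ X Z = (t₁ * t₂ + t₂ * t₁) - G₂ X Z

  cubic≡resultant : ∀ t₁ t₂ X Z → cubic (t₁ , t₂ , X , Z) ≡ w₂ t₁ t₂ X Z * L₁ X Z - w₁ t₁ t₂ X Z * L₂ X Z
  cubic≡resultant t₁ t₂ X Z = solve 15 (λ w a₁ a₂ b₁ b₂ c₁ c₂ d₁ d₂ e₁ e₂ X Z t₁ t₂ →
    let A  = a₁ :* b₂ :- a₂ :* b₁
        B  = b₂ :* c₁ :- b₁ :* c₂ :- a₂ :* d₁ :+ a₁ :* d₂
        C  = :- (c₂ :* d₁) :+ c₁ :* d₂ :+ b₂ :* e₁ :- b₁ :* e₂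
        D  = d₂ :* e₁ :- d₁ :* e₂
        L₁ = b₁ :* X :+ d₁ :* Z
        L₂ = b₂ :* X :+ d₂ :* Z
        w₁ = (t₁ :* t₁ :+ w :* (t₂ :* t₂)) :- (a₁ :* X :* X :+ c₁ :* X :* Z :+ e₁ :* Z :* Z)
        w₂ = (t₁ :* t₂ :+ t₂ :* t₁) :- (a₂ :* X :* X :+ c₂ :* X :* Z :+ e₂ :* Z :* Z)
    in κ 2 :* t₁ :* t₂ :* L₁ :- (t₁ :* t₁ :+ w :* (t₂ :* t₂)) :* L₂
         :+ A :* X :* X :* X :+ B :* X :* X :* Z :+ C :* X :* Z :* Z :+ D :* Z :* Z :* Z
       := w₂ :* L₁ :- w₁ :* L₂) refl ω a₁ a₂ b₁ b₂ c₁ c₂ d₁ d₂ e₁ e₂ X Z t₁ t₂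

  L≢0 : b₁ * d₂ - b₂ * d₁ ≢ 0# → ∀ X Z → ¬ (X ≡ 0# × Z ≡ 0#) → ¬ (L₁ X Z ≡ 0# × L₂ X Z ≡ 0#)
  L≢0 det≢0 X Z XZ≢0 (L₁≡0 , L₂≡0) = XZ≢0 (cancel-det X (begin
      (b₁ * d₂ - b₂ * d₁) * X        ≡⟨ solve 6 (λ b₁ b₂ d₁ d₂ X Z →
                                          (b₁ :* d₂ :- b₂ :* d₁) :* X := d₂ :* (b₁ :* X :+ d₁ :* Z) :- d₁ :* (b₂ :* X :+ d₂ :* Z))
                                          refl b₁ b₂ d₁ d₂ X Z ⟩
      d₂ * L₁ X Z - d₁ * L₂ X Z      ≡⟨ cong₂ (λ l₁ l₂ → d₂ * l₁ - d₁ * l₂) L₁≡0 L₂≡0 ⟩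
      d₂ * 0# - d₁ * 0#              ≡⟨ solve 2 (λ d₁ d₂ → d₂ :* κ 0 :- d₁ :* κ 0 := κ 0) refl d₁ d₂ ⟩
      0#                             ∎)
    , cancel-det Z (begin
      (b₁ * d₂ - b₂ * d₁) * Z        ≡⟨ solve 6 (λ b₁ b₂ d₁ d₂ X Z →
                                          (b₁ :* d₂ :- b₂ :* d₁) :* Z := b₁ :* (b₂ :* X :+ d₂ :* Z) :- b₂ :* (b₁ :* X :+ d₁ :* Z))
                                          refl b₁ b₂ d₁ d₂ X Z ⟩
      b₁ * L₂ X Z - b₂ * L₁ X Z      ≡⟨ cong₂ (λ l₂ l₁ → b₁ * l₂ - b₂ * l₁) L₂≡0 L₁≡0 ⟩
      b₁ * 0# - b₂ * 0#              ≡⟨ solve 2 (λ b₁ b₂ → b₁ :* κ 0 :- b₂ :* κ 0 := κ 0) refl b₁ b₂ ⟩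
      0#                             ∎))
    where
    open ≡-Reasoning
    cancel-det : ∀ x → (b₁ * d₂ - b₂ * d₁) * x ≡ 0# → x ≡ 0#
    cancel-det x eq = *-cancelˡ det≢0 (trans eq (sym (zeroʳ _)))

  ∑-t²≡form : b₁ * d₂ - b₂ * d₁ ≢ 0# → ∀ X Z → ¬ (X ≡ 0# × Z ≡ 0#) → ∀ t →
    ∑ᶠ[ Y ] F².δ (t *₂ t) (form (embᵖ (X , Y , Z))) ≡ toℕ (isZero (cubic (proj₁ t , proj₂ t , X , Z)))
  ∑-t²≡form det≢0 X Z XZ≢0 (t₁ , t₂) = begin
    ∑ᶠ[ Y ] F².δ ((t₁ , t₂) *₂ (t₁ , t₂)) (form (embᵖ (X , Y , Z)))
      ≡⟨ ∑-cong elements (λ Y → cong toℕ (trans (cong (λ s → does (((t₁ , t₂) *₂ (t₁ , t₂)) ≟₂ s)) (form-affine X Y Z))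
                                                (trans (does-≟₂ _ _) (cong₂ _∧_ (does-shift _ _ _) (does-shift _ _ _))))) ⟩
    ∑ᶠ[ Y ] toℕ (does ((Y * L₁ X Z) ≟ w₁ t₁ t₂ X Z) ∧ does ((Y * L₂ X Z) ≟ w₂ t₁ t₂ X Z))
      ≡⟨ ∑ᶠ-linear-system (L₁ X Z) (L₂ X Z) _ _ (L≢0 det≢0 X Z XZ≢0) ⟩
    toℕ (isZero (w₂ t₁ t₂ X Z * L₁ X Z - w₁ t₁ t₂ X Z * L₂ X Z))
      ≡⟨ cong (λ x → toℕ (isZero x)) (cubic≡resultant t₁ t₂ X Z) ⟨
    toℕ (isZero (cubic (t₁ , t₂ , X , Z))) ∎
    where
    open ≡-Reasoning
    does-shift : ∀ s y g → does (s ≟ (y + g)) ≡ does (y ≟ (s - g))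
    does-shift s y g = does-cong (s ≟ (y + g)) (y ≟ (s - g))
      (λ s≡y+g → trans (solve 2 (λ y g → y := (y :+ g) :- g) refl y g) (cong (_- g) (sym s≡y+g)))
      (λ y≡s-g → trans (solve 2 (λ s g → s := (s :- g) :+ g) refl s g) (cong (_+ g) (sym y≡s-g)))

  nonzero₂≡nonzeroᵛ : ∀ t → F².nonzero t ≡ nonzeroᵛ 1 t
  nonzero₂≡nonzeroᵛ t = cong (λ b → toℕ (not b)) (does-≟₂ t 0₂)

  nonzeroSquareRoots-0 : nonzeroSquareRoots 0₂ ≡ 0
  nonzeroSquareRoots-0 = trans (∑-cong elements₂ no-root) (∑-zero elements₂)
    where
    no-root : ∀ t → F².nonzero t *ℕ F².δ (t *₂ t) 0₂ ≡ 0
    no-root t with t ≟₂ 0₂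
    ... | yes _   = refl
    ... | no t≢0  = cong (λ b → toℕ b +ℕ 0) (A².isZero-≢0 (A².*-≢0 t≢0 t≢0))

  ∑-nonzeroSquareRoots≡mixedZeros : b₁ * d₂ - b₂ * d₁ ≢ 0# →
    ∑ᵛ 2 (λ v → nonzeroᵛ 2 v *ℕ nonzeroSquareRoots (form (embᵖ v))) ≡ mixedZeros
  ∑-nonzeroSquareRoots≡mixedZeros det≢0 = begin
    ∑ᵛ 2 (λ v → nonzeroᵛ 2 v *ℕ R′ v)
      ≡⟨ ∑ᵛ-cong 2 (λ { (X , Y , Z) → on-line X Y Z }) ⟩
    ∑ᶠ[ X ] ∑ᶠ[ Y ] ∑ᶠ[ Z ] (nonzeroᵛ 1 (X , Z) *ℕ R′ (X , Y , Z))
      ≡⟨ ∑-cong elements (λ X → trans (∑-comm elements elements _) (∑-cong elements (λ Z → ∑-*ˡ elements (nonzeroᵛ 1 (X , Z)) _))) ⟩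
    ∑ᶠ[ X ] ∑ᶠ[ Z ] (nonzeroᵛ 1 (X , Z) *ℕ ∑ᶠ[ Y ] R′ (X , Y , Z))
      ≡⟨ ∑-cong elements (λ X → ∑-cong elements (λ Z → nonzero-cong X Z)) ⟩
    mixedZeros ∎
    where
    open ≡-Reasoning
    R′ : Vector 2 → ℕ
    R′ v = nonzeroSquareRoots (form (embᵖ v))
    on-line : ∀ X Y Z → nonzeroᵛ 2 (X , Y , Z) *ℕ R′ (X , Y , Z) ≡ nonzeroᵛ 1 (X , Z) *ℕ R′ (X , Y , Z)
    on-line X Y Z with X ≟ 0# | Z ≟ 0#
    ... | no _     | _        = refl
    ... | yes _    | no _     = cong (λ b → toℕ (not b) *ℕ R′ (X , Y , Z)) (Bool.∧-zeroʳ (isZero Y))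
    ... | yes refl | yes refl = trans (cong (toℕ (not (true ∧ isZero Y ∧ true)) *ℕ_) R′≡0)
                                      (trans (ℕ.*-zeroʳ (toℕ (not (isZero Y ∧ true)))) (sym (cong (toℕ (not (true ∧ true)) *ℕ_) R′≡0)))
      where
      R′≡0 : R′ (0# , Y , 0#) ≡ 0
      R′≡0 = trans (cong nonzeroSquareRoots (trans (form-affine 0# Y 0#) (cong₂ _,_
               (solve 6 (λ Y b d a c e → Y :* (b :* κ 0 :+ d :* κ 0) :+ (a :* κ 0 :* κ 0 :+ c :* κ 0 :* κ 0 :+ e :* κ 0 :* κ 0) := κ 0)
                 refl Y b₁ d₁ a₁ c₁ e₁)
               (solve 6 (λ Y b d a c e → Y :* (b :* κ 0 :+ d :* κ 0) :+ (a :* κ 0 :* κ 0 :+ c :* κ 0 :* κ 0 :+ e :* κ 0 :* κ 0) := κ 0)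
                 refl Y b₂ d₂ a₂ c₂ e₂))))
             nonzeroSquareRoots-0
    line : ∀ X Z → ¬ (X ≡ 0# × Z ≡ 0#) → ∑ᶠ[ Y ] R′ (X , Y , Z)
      ≡ ∑ᵛ 1 (λ { (t₁ , t₂) → nonzeroᵛ 1 (t₁ , t₂) *ℕ toℕ (isZero (cubic (t₁ , t₂ , X , Z))) })
    line X Z XZ≢0 = begin
      ∑ᶠ[ Y ] ∑ elements₂ (λ t → F².nonzero t *ℕ F².δ (t *₂ t) (form (embᵖ (X , Y , Z))))
        ≡⟨ ∑-comm elements elements₂ _ ⟩
      ∑ elements₂ (λ t → ∑ᶠ[ Y ] (F².nonzero t *ℕ F².δ (t *₂ t) (form (embᵖ (X , Y , Z)))))
        ≡⟨ ∑-cong elements₂ (λ t → trans (∑-*ˡ elements (F².nonzero t) _)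
             (cong₂ _*ℕ_ (nonzero₂≡nonzeroᵛ t) (∑-t²≡form det≢0 X Z XZ≢0 t))) ⟩
      ∑ elements₂ (λ t → nonzeroᵛ 1 t *ℕ toℕ (isZero (cubic (proj₁ t , proj₂ t , X , Z))))
        ≡⟨ ∑-vectors 1 _ ⟩
      ∑ᵛ 1 (λ { (t₁ , t₂) → nonzeroᵛ 1 (t₁ , t₂) *ℕ toℕ (isZero (cubic (t₁ , t₂ , X , Z))) }) ∎
    nonzero-cong : ∀ X Z → nonzeroᵛ 1 (X , Z) *ℕ ∑ᶠ[ Y ] R′ (X , Y , Z)
      ≡ nonzeroᵛ 1 (X , Z) *ℕ ∑ᵛ 1 (λ { (t₁ , t₂) → nonzeroᵛ 1 (t₁ , t₂) *ℕ toℕ (isZero (cubic (t₁ , t₂ , X , Z))) })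
    nonzero-cong X Z with X ≟ 0# | Z ≟ 0#
    ... | yes refl | yes refl = refl
    ... | no X≢0   | _        = cong (_+ℕ 0) (line X Z (λ (X≡0 , _) → X≢0 X≡0))
    ... | yes _    | no Z≢0   = cong (_+ℕ 0) (line X Z (λ (_ , Z≡0) → Z≢0 Z≡0))

lemma5p8 :
  (𝔽 : FiniteField) → let open FiniteField 𝔽 in
  (∃ λ k → order ≡ suc (k +ℕ k)) →
  (ω : Carrier) → (∀ x → x * x ≢ ω) →
  (a b c d e : Ext.F2 𝔽 ω) →
  let open Ext 𝔽 ω
      open Conic a b c d e
      a₁ = proj₁ a
      a₂ = proj₂ a
      b₁ = proj₁ b
      b₂ = proj₂ b
      c₁ = proj₁ c
      c₂ = proj₂ c
      d₁ = proj₁ d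
      d₂ = proj₂ d
      e₁ = proj₁ e
      e₂ = proj₂ e
      A = a₁ * b₂ - a₂ * b₁
      B = b₂ * c₁ - b₁ * c₂ - a₂ * d₁ + a₁ * d₂
      C = - (c₂ * d₁) + c₁ * d₂ + b₂ * e₁ - b₁ * e₂
      D = d₂ * e₁ - d₁ * e₂
      open Cubic b₁ b₂ d₁ d₂ A B C D
  in
  NonSingular →
  b ≢ 0₂ →
  d ≡ 1₂ →
  b₂ ≢ 0# →
  b₁ * d₂ - b₂ * d₁ ≢ 0# →
  isSquare₂ ((-₂ (b *₂ c *₂ d)) +₂ a *₂ d *₂ d +₂ b *₂ b *₂ e) →
  2 *ℕ Eq +ℕ n₀ +ℕ n∞ ≡ Sq
lemma5p8 𝔽 odd ω nonsquare a b c d e nonsingular _ _ _ det≢0 square = *-cancel-order∸1 (begin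
  q-1 *ℕ (2 *ℕ Eq +ℕ n₀ +ℕ n∞)
    ≡⟨ solve 4 (λ q E m n → q :* (con 2 :* E :+ m :+ n) := con 2 :* (q :* E) :+ (q :* m :+ q :* n)) refl q-1 Eq n₀ n∞ ⟩
  2 *ℕ (q-1 *ℕ Eq) +ℕ (q-1 *ℕ n₀ +ℕ q-1 *ℕ n∞)
    ≡⟨ cong (_+ℕ (q-1 *ℕ n₀ +ℕ q-1 *ℕ n∞)) (trans (twice-Eq nonsingular square) (∑-nonzeroSquareRoots≡mixedZeros det≢0)) ⟩
  mixedZeros +ℕ (q-1 *ℕ n₀ +ℕ q-1 *ℕ n∞)
    ≡⟨ ℕ.+-comm mixedZeros _ ⟩
  q-1 *ℕ n₀ +ℕ q-1 *ℕ n∞ +ℕ mixedZeros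
    ≡⟨ Sq-decomposition ⟨
  q-1 *ℕ Sq ∎)
  where
  open ≡-Reasoning
  open +-*-Solver
  open FiniteField 𝔽 using (order)
  open FieldSums 𝔽 using (*-cancel-order∸1; odd-order⇒2≢0)
  open ExternalPoints 𝔽 ω nonsquare (odd-order⇒2≢0 odd) a b c d e
  open CubicSurface 𝔽 ω b₁ b₂ d₁ d₂ A B C D
  open Ext.Conic 𝔽 ω a b c d e using (Eq)
  open Ext.Cubic 𝔽 ω b₁ b₂ d₁ d₂ A B C D using (Sq; n₀; n∞)
  q-1 = order ∸ 1
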